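{- Let $\mathbb{T}$ be an algebraic theory in an algebraic language $L$ and let $x:A\vdash s=_Bt$ be an $L$-formula. Then $x:A\vdash s=_Bt$ is a theorem of $\mathbb{T}$ if and only if it is satisfied by every $\mathbb{T}$-model in every monoidal category (i.e. the monoidal semantics is sound and complete).
   Context: Algebraic languages: fix a finitary many-sorted signature $\Sigma$ (atomic types; functional constants $f\colon B_1,\dots,B_n\to B_{n+1}$). Types are finite sequences of atomic types (juxtaposition; $\emptyset$ empty). Raw terms: $t::=\emptyset\mid x\mid f(t_1,\dots,t_n)\mid tt$, tensor associative with unit $\emptyset$; $t[s/x]$ is simultaneous substitution of $s=s_1\dots s_n$ for distinct atomic variables $x=x_1\dots x_n$. Sequents $x:A\vdash t:B$ with $x$ distinct atomic variables. Term calculus: Variables $x:A\vdash x:A$ ($x,A$ atomic); Functions: from $x_i:A_i\vdash t_i:B_i$ infer $x_1\dots x_n:A_1\dots A_n\vdash f(t_1,\dots,t_n):B_{n+1}$; Substitution: from $x:A\vdash s:B$, $y:B\vdash t:C$ infer $x:A\vdash t[s/y]:C$; Unit $\emptyset:\emptyset\vdash\emptyset:\emptyset$; Tensor: from $x:A\vdash s:B$, $y:C\vdash t:D$ infer $xy:AC\vdash st:BD$; Weakening: from $x_1x_3:A_1A_3\vdash t:B$ infer $x_1x_2x_3:A_1A_2A_3\vdash t:B$; Exchange: from $x:A\vdash t:B$ infer $\sigma x:\sigma A\vdash t:B$; Contraction: from $x_1xx'x_2:A_1AAA_2\vdash t:B$ infer $x_1xx_2:A_1AA_2\vdash t[x/x']:B$.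 An algebraic language $L$ is $\Sigma$ plus a subset of {weakening, exchange, contraction}; its terms are the sequents derivable with all non-structural rules and its structural rules. Theories: an $L$-formula is $x:A\vdash t_1=_Bt_2$ with both $x:A\vdash t_i:B$ terms of $L$. Deduction calculus: reflexivity, symmetry, transitivity; substitution (from $x:A\vdash s=_Bs'$, $y:B\vdash t=_Ct'$ infer $x:A\vdash t[s/y]=_Ct'[s'/y]$); tensor (from $x:A\vdash s=_Ss'$, $y:B\vdash t=_Tt'$ infer $xy:AB\vdash st=_{ST}s't'$); and the structural rules of $L$ applied to formulas. An algebraic theory is $L$ with a set of formulas (axioms); theorems are formulas deducible from the axioms. Semantics: in a monoidal category $\mathbf{C}$, an $L$-prestructure assigns objects $|A|$ to atomic types (extended by tensor, $|\emptyset|=1$), arrows $|f|\colon|B_1|\dots|B_n|\to|B_{n+1}|$, and for the structural rules of $L$ arrows $\pi_A\colon|A|\to1$, $\sigma_A\colon|\sigma A|\to|A|$, $\Delta_A\colon|A|\to|AA|$ for all types $A$. Derivations are interpreted inductively (variables as identities, functions as tensor followed by $|f|$, substitution as composition, tensor as tensor, weakening/exchange/contraction as precomposition with $1\pi_A1$, $\sigma_A$, $1\Delta_A1$, coherence isomorphisms inserted as needed); an $L$-structure is a prestructure whose interpretation of each term is independent of the derivation. A structure $M$ satisfies $x:A\vdash s=_Bt$ iff $|s|_M=|t|_M\colon|A|\to|B|$; a $\mathbb{T}$-model is an $L$-structure satisfying all axioms of $\mathbb{T}$. -}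

module Defs where

open import Level using (Level; _⊔_; Setω) renaming (suc to lsuc)
open import Data.Bool using (Bool; true; false; if_then_else_; T)
open import Data.Nat using (ℕ; zero; suc; _≡ᵇ_)
open import Data.Fin using (Fin; zero; suc)
open import Data.Fin.Permutation using (Permutation′; _⟨$⟩ʳ_)
open import Data.List using (List; []; _∷_; _++_; length; tabulate; lookup)
open import Data.List.Relation.Unary.Unique.Propositional using (Unique)
open import Relation.Binary.Structures using (IsEquivalence)

record MonoidalCategory (o ℓ e : Level) : Set (lsuc (o ⊔ ℓ ⊔ e)) where
  infixr 9 _∘_
  infixr 10 _⊗₀_ _⊗₁_
  infix 4 _≈_ _⇒_
  field
    Obj : Set o
    _⇒_ : Obj → Obj → Set ℓ
    _≈_ : ∀ {A B} → A ⇒ B → A ⇒ B → Set e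
    ≈-equiv : ∀ {A B} → IsEquivalence (_≈_ {A} {B})
    id : ∀ {A} → A ⇒ A
    _∘_ : ∀ {A B C} → B ⇒ C → A ⇒ B → A ⇒ C
    assoc : ∀ {A B C D} {f : A ⇒ B} {g : B ⇒ C} {h : C ⇒ D} →
            (h ∘ g) ∘ f ≈ h ∘ (g ∘ f)
    identityˡ : ∀ {A B} {f : A ⇒ B} → id ∘ f ≈ f
    identityʳ : ∀ {A B} {f : A ⇒ B} → f ∘ id ≈ f
    ∘-resp-≈ : ∀ {A B C} {f h : B ⇒ C} {g i : A ⇒ B} →
               f ≈ h → g ≈ i → f ∘ g ≈ h ∘ i
    unit : Obj
    _⊗₀_ : Obj → Obj → Obj
    _⊗₁_ : ∀ {A B C D} → A ⇒ B → C ⇒ D → A ⊗₀ C ⇒ B ⊗₀ D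
    ⊗-identity : ∀ {A B} → id {A} ⊗₁ id {B} ≈ id
    ⊗-homomorphism : ∀ {X Y Z U V W} {f : Y ⇒ Z} {g : X ⇒ Y} {h : V ⇒ W} {i : U ⇒ V} →
                     (f ∘ g) ⊗₁ (h ∘ i) ≈ (f ⊗₁ h) ∘ (g ⊗₁ i)
    ⊗-resp-≈ : ∀ {A B C D} {f g : A ⇒ B} {h i : C ⇒ D} →
               f ≈ g → h ≈ i → f ⊗₁ h ≈ g ⊗₁ i
    associator⇒ : ∀ {X Y Z} → (X ⊗₀ Y) ⊗₀ Z ⇒ X ⊗₀ (Y ⊗₀ Z)
    associator⇐ : ∀ {X Y Z} → X ⊗₀ (Y ⊗₀ Z) ⇒ (X ⊗₀ Y) ⊗₀ Z
    associator-isoˡ : ∀ {X Y Z} → associator⇐ ∘ associator⇒ {X} {Y} {Z} ≈ id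
    associator-isoʳ : ∀ {X Y Z} → associator⇒ ∘ associator⇐ {X} {Y} {Z} ≈ id
    associator-natural : ∀ {X Y Z X′ Y′ Z′} {f : X ⇒ X′} {g : Y ⇒ Y′} {h : Z ⇒ Z′} →
                         associator⇒ ∘ ((f ⊗₁ g) ⊗₁ h) ≈ (f ⊗₁ (g ⊗₁ h)) ∘ associator⇒
    unitorˡ⇒ : ∀ {X} → unit ⊗₀ X ⇒ X
    unitorˡ⇐ : ∀ {X} → X ⇒ unit ⊗₀ X
    unitorˡ-isoˡ : ∀ {X} → unitorˡ⇐ ∘ unitorˡ⇒ {X} ≈ id
    unitorˡ-isoʳ : ∀ {X} → unitorˡ⇒ ∘ unitorˡ⇐ {X} ≈ id
    unitorˡ-natural : ∀ {X Y} {f : X ⇒ Y} → unitorˡ⇒ ∘ (id ⊗₁ f) ≈ f ∘ unitorˡ⇒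
    unitorʳ⇒ : ∀ {X} → X ⊗₀ unit ⇒ X
    unitorʳ⇐ : ∀ {X} → X ⇒ X ⊗₀ unit
    unitorʳ-isoˡ : ∀ {X} → unitorʳ⇐ ∘ unitorʳ⇒ {X} ≈ id
    unitorʳ-isoʳ : ∀ {X} → unitorʳ⇒ ∘ unitorʳ⇐ {X} ≈ id
    unitorʳ-natural : ∀ {X Y} {f : X ⇒ Y} → unitorʳ⇒ ∘ (f ⊗₁ id) ≈ f ∘ unitorʳ⇒
    triangle : ∀ {X Y} → (id {X} ⊗₁ unitorˡ⇒ {Y}) ∘ associator⇒ ≈ unitorʳ⇒ ⊗₁ id
    pentagon : ∀ {W X Y Z} →
               (id {W} ⊗₁ associator⇒ {X} {Y} {Z}) ∘ associator⇒ ∘ (associator⇒ ⊗₁ id)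
                 ≈ associator⇒ ∘ associator⇒

record Signature : Set₁ where
  field
    Sort : Set
    Fun  : Set
    dom  : Fun → List Sort
    cod  : Fun → Sort

record Language : Set₁ where
  field
    sig : Signature
    weakening exchange contraction : Bool
  open Signature sig public

-- Variables are natural numbers.  A list of variables typed by a type A
-- (a list of atomic types) is an element of  Vars A.
data Vars {X : Set} : List X → Set where
  []  : Vars []
  _∷_ : ∀ {a A} → ℕ → Vars A → Vars (a ∷ A)

module _ {X : Set} where
  infixr 5 _++ᵛ_
  _++ᵛ_ : ∀ {A B : List X} → Vars A → Vars B → Vars (A ++ B)
  [] ++ᵛ ys = ys
  (x ∷ xs) ++ᵛ ys = x ∷ (xs ++ᵛ ys)

  varList : ∀ {A : List X} → Vars A → List ℕ
  varList [] = []
  varList (x ∷ xs) = x ∷ varList xs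

  lookupᵛ : ∀ {A : List X} → Vars A → Fin (length A) → ℕ
  lookupᵛ (x ∷ xs) zero = x
  lookupᵛ (x ∷ xs) (suc i) = lookupᵛ xs i

  tabulateᵛ : ∀ {n} (f : Fin n → X) → (Fin n → ℕ) → Vars (tabulate f)
  tabulateᵛ {zero} f g = []
  tabulateᵛ {suc n} f g = g zero ∷ tabulateᵛ (λ i → f (suc i)) (λ i → g (suc i))

  permute : (A : List X) → Permutation′ (length A) → List X
  permute A σ = tabulate (λ i → lookup A (σ ⟨$⟩ʳ i))

  permuteᵛ : ∀ {A : List X} (x : Vars A) (σ : Permutation′ (length A)) → Vars (permute A σ)
  permuteᵛ {A} x σ = tabulateᵛ (λ i → lookup A (σ ⟨$⟩ʳ i)) (λ i → lookupᵛ x (σ ⟨$⟩ʳ i))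

-- Raw terms.  Since tensor is associative with unit ∅, a raw term is a
-- finite sequence of "atoms" (variables or applications f(t₁,…,tₙ));
-- ∅ is the empty sequence and tensor is concatenation.

module _ {F : Set} where
  mutual
    data Atom : Set where
      var : ℕ → Atom
      app : F → List (List Atom) → Atom

  RawTerm : Set
  RawTerm = List Atom

  substVar : List ℕ → RawTerm → ℕ → Atom
  substVar [] ss z = var z
  substVar (y ∷ ys) [] z = var z
  substVar (y ∷ ys) (s ∷ ss) z = if y ≡ᵇ z then s else substVar ys ss z

  mutual
    substAtom : List ℕ → RawTerm → Atom → Atom
    substAtom ys ss (var z) = substVar ys ss z
    substAtom ys ss (app f ts) = app f (substTerms ys ss ts)

    substTerm : List ℕ → RawTerm → RawTerm → RawTerm
    substTerm ys ss [] = []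
    substTerm ys ss (a ∷ as) = substAtom ys ss a ∷ substTerm ys ss as

    substTerms : List ℕ → RawTerm → List RawTerm → List RawTerm
    substTerms ys ss [] = []
    substTerms ys ss (t ∷ ts) = substTerm ys ss t ∷ substTerms ys ss ts

  infix 8 _[_/_]
  _[_/_] : RawTerm → RawTerm → List ℕ → RawTerm
  t [ s / ys ] = substTerm ys s t

  varTerm : ∀ {X : Set} {A : List X} → Vars A → RawTerm
  varTerm [] = []
  varTerm (x ∷ xs) = var x ∷ varTerm xs

module _ (L : Language) where
  open Language L

  Term : Set
  Term = RawTerm {Fun}

  Distinct : ∀ {A : List Sort} → Vars A → Set
  Distinct x = Unique (varList x)

  infix 3 _⊢_∶_
  mutual
    data _⊢_∶_ : {A : List Sort} → Vars A → Term → List Sort → Set where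
      var  : (x : ℕ) (a : Sort) → _⊢_∶_ {a ∷ []} (x ∷ []) (var x ∷ []) (a ∷ [])
      fun  : ∀ {A} {x : Vars A} {ts} (f : Fun) →
             Args x ts (dom f) → Distinct x →
             x ⊢ app f ts ∷ [] ∶ cod f ∷ []
      sub  : ∀ {A B C} {x : Vars A} {y : Vars B} {s t} →
             x ⊢ s ∶ B → y ⊢ t ∶ C → x ⊢ t [ s / varList y ] ∶ C
      empty : [] ⊢ [] ∶ []
      tens : ∀ {A B C D} {x : Vars A} {y : Vars C} {s t} →
             x ⊢ s ∶ B → y ⊢ t ∶ D → Distinct (x ++ᵛ y) →
             x ++ᵛ y ⊢ s ++ t ∶ B ++ D
      weak : T weakening → ∀ {A₁ A₂ A₃ B} {x₁ : Vars A₁} {x₂ : Vars A₂} {x₃ : Vars A₃} {t} →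
             x₁ ++ᵛ x₃ ⊢ t ∶ B → Distinct (x₁ ++ᵛ x₂ ++ᵛ x₃) →
             x₁ ++ᵛ x₂ ++ᵛ x₃ ⊢ t ∶ B
      exch : T exchange → ∀ {A B} {x : Vars A} {t} (σ : Permutation′ (length A)) →
             x ⊢ t ∶ B → permuteᵛ x σ ⊢ t ∶ B
      contr : T contraction → ∀ {A₁ A A₂ B} {x₁ : Vars A₁} {x x′ : Vars A} {x₂ : Vars A₂} {t} →
              x₁ ++ᵛ x ++ᵛ x′ ++ᵛ x₂ ⊢ t ∶ B →
              x₁ ++ᵛ x ++ᵛ x₂ ⊢ t [ varTerm x / varList x′ ] ∶ B

    data Args : {A : List Sort} → Vars A → List Term → List Sort → Set where
      []  : Args [] [] []
      _∷_ : ∀ {A As b bs} {x : Vars A} {xs : Vars As} {t ts} →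
            x ⊢ t ∶ b ∷ [] → Args xs ts bs → Args (x ++ᵛ xs) (t ∷ ts) (b ∷ bs)

  record Formula : Set where
    constructor formula
    field
      {ctxType} : List Sort
      ctx : Vars ctxType
      type : List Sort
      lhs rhs : Term
      lhsTerm : ctx ⊢ lhs ∶ type
      rhsTerm : ctx ⊢ rhs ∶ type

record Theory (L : Language) : Set₁ where
  field
    Axiom : Formula L → Set

module _ {L : Language} (𝕋 : Theory L) where
  open Language L
  open Theory 𝕋

  data Thm : {A : List Sort} → Vars A → Term L → Term L → List Sort → Set where
    ax    : (φ : Formula L) → Axiom φ →
            Thm (Formula.ctx φ) (Formula.lhs φ) (Formula.rhs φ) (Formula.type φ)
    refl  : ∀ {A B} {x : Vars A} {t} → _⊢_∶_ L x t B → Thm x t t B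
    sym   : ∀ {A B} {x : Vars A} {s t} → Thm x s t B → Thm x t s B
    trans : ∀ {A B} {x : Vars A} {s t u} → Thm x s t B → Thm x t u B → Thm x s u B
    sub   : ∀ {A B C} {x : Vars A} {y : Vars B} {s s′ t t′} →
            Thm x s s′ B → Thm y t t′ C →
            Thm x (t [ s / varList y ]) (t′ [ s′ / varList y ]) C
    tens  : ∀ {A B S U} {x : Vars A} {y : Vars B} {s s′ t t′} →
            Thm x s s′ S → Thm y t t′ U → Distinct L (x ++ᵛ y) →
            Thm (x ++ᵛ y) (s ++ t) (s′ ++ t′) (S ++ U)
    weak  : T weakening → ∀ {A₁ A₂ A₃ B} {x₁ : Vars A₁} {x₂ : Vars A₂} {x₃ : Vars A₃} {s t} →
            Thm (x₁ ++ᵛ x₃) s t B → Distinct L (x₁ ++ᵛ x₂ ++ᵛ x₃) →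
            Thm (x₁ ++ᵛ x₂ ++ᵛ x₃) s t B
    exch  : T exchange → ∀ {A B} {x : Vars A} {s t} (σ : Permutation′ (length A)) →
            Thm x s t B → Thm (permuteᵛ x σ) s t B
    contr : T contraction → ∀ {A₁ A A₂ B} {x₁ : Vars A₁} {x x′ : Vars A} {x₂ : Vars A₂} {s t} →
            Thm (x₁ ++ᵛ x ++ᵛ x′ ++ᵛ x₂) s t B →
            Thm (x₁ ++ᵛ x ++ᵛ x₂) (s [ varTerm x / varList x′ ]) (t [ varTerm x / varList x′ ]) B

module _ {o ℓ e : Level} (𝐂 : MonoidalCategory o ℓ e) where
  open MonoidalCategory 𝐂

  ⟦_⟧ₜ[_] : {S : Set} → List S → (S → Obj) → Obj
  ⟦ [] ⟧ₜ[ I ] = unit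
  ⟦ a ∷ A ⟧ₜ[ I ] = I a ⊗₀ ⟦ A ⟧ₜ[ I ]

  module _ {S : Set} (I : S → Obj) where
    split : (A C : List S) → ⟦ A ++ C ⟧ₜ[ I ] ⇒ ⟦ A ⟧ₜ[ I ] ⊗₀ ⟦ C ⟧ₜ[ I ]
    split [] C = unitorˡ⇐
    split (a ∷ A) C = associator⇐ ∘ (id ⊗₁ split A C)

    merge : (A C : List S) → ⟦ A ⟧ₜ[ I ] ⊗₀ ⟦ C ⟧ₜ[ I ] ⇒ ⟦ A ++ C ⟧ₜ[ I ]
    merge [] C = unitorˡ⇒
    merge (a ∷ A) C = (id ⊗₁ merge A C) ∘ associator⇒

  module _ (L : Language) where
    open Language L

    record Prestructure : Set (o ⊔ ℓ) where
      field
        sort : Sort → Obj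
        func : (f : Fun) → ⟦ dom f ⟧ₜ[ sort ] ⇒ sort (cod f)
        π    : T weakening → (A : List Sort) → ⟦ A ⟧ₜ[ sort ] ⇒ unit
        σ    : T exchange → (A : List Sort) (τ : Permutation′ (length A)) →
               ⟦ permute A τ ⟧ₜ[ sort ] ⇒ ⟦ A ⟧ₜ[ sort ]
        Δ    : T contraction → (A : List Sort) → ⟦ A ⟧ₜ[ sort ] ⇒ ⟦ A ++ A ⟧ₜ[ sort ]

    module Interp (P : Prestructure) where
      open Prestructure P
      ⟦_⟧ : List Sort → Obj
      ⟦ A ⟧ = ⟦ A ⟧ₜ[ sort ]

      spl = split sort
      mrg = merge sort

      mutual
        ⟦_⟧d : ∀ {A B} {x : Vars A} {t} → _⊢_∶_ L x t B → ⟦ A ⟧ ⇒ ⟦ B ⟧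
        ⟦ var x a ⟧d = id
        ⟦ fun f args _ ⟧d = unitorʳ⇐ ∘ func f ∘ ⟦ args ⟧a
        ⟦ sub d₁ d₂ ⟧d = ⟦ d₂ ⟧d ∘ ⟦ d₁ ⟧d
        ⟦ empty ⟧d = id
        ⟦ tens {A} {B} {C} {D} d₁ d₂ _ ⟧d =
          mrg B D ∘ (⟦ d₁ ⟧d ⊗₁ ⟦ d₂ ⟧d) ∘ spl A C
        ⟦ weak w {A₁} {A₂} {A₃} d _ ⟧d =
          ⟦ d ⟧d ∘ mrg A₁ A₃ ∘ (id ⊗₁ (unitorˡ⇒ ∘ (π w A₂ ⊗₁ id) ∘ spl A₂ A₃)) ∘ spl A₁ (A₂ ++ A₃)
        ⟦ exch e {A} τ d ⟧d = ⟦ d ⟧d ∘ σ e A τ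
        ⟦ contr c {A₁} {A} {A₂} d ⟧d =
          ⟦ d ⟧d ∘ mrg A₁ (A ++ A ++ A₂)
                 ∘ (id ⊗₁ (mrg A (A ++ A₂) ∘ (id ⊗₁ mrg A A₂) ∘ associator⇒
                           ∘ ((spl A A ∘ Δ c A) ⊗₁ id) ∘ spl A A₂))
                 ∘ spl A₁ (A ++ A₂)

        ⟦_⟧a : ∀ {A bs} {x : Vars A} {ts} → Args L x ts bs → ⟦ A ⟧ ⇒ ⟦ bs ⟧
        ⟦ [] ⟧a = id
        ⟦ _∷_ {A} {As} d args ⟧a = ((unitorʳ⇒ ∘ ⟦ d ⟧d) ⊗₁ ⟦ args ⟧a) ∘ spl A As

    record Structure : Set (o ⊔ ℓ ⊔ e) where
      field
        prestructure : Prestructure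
      open Interp prestructure
      field
        coherent : ∀ {A B} {x : Vars A} {t} (d d′ : _⊢_∶_ L x t B) → ⟦ d ⟧d ≈ ⟦ d′ ⟧d

    _⊨_ : Structure → Formula L → Set e
    M ⊨ φ = ⟦ Formula.lhsTerm φ ⟧d ≈ ⟦ Formula.rhsTerm φ ⟧d
      where open Interp (Structure.prestructure M)

  record Model {L : Language} (𝕋 : Theory L) : Set (o ⊔ ℓ ⊔ e) where
    field
      structure : Structure L
      satisfies : ∀ φ → Theory.Axiom 𝕋 φ → _⊨_ L structure φ

Valid : {L : Language} (𝕋 : Theory L) → Formula L → Setω
Valid {L} 𝕋 φ = ∀ {o ℓ e} (𝐂 : MonoidalCategory o ℓ e) (M : Model 𝐂 𝕋) →
                _⊨_ 𝐂 L (Model.structure M) φ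

IsTheorem : {L : Language} (𝕋 : Theory L) → Formula L → Set
IsTheorem 𝕋 φ = Thm 𝕋 (Formula.ctx φ) (Formula.lhs φ) (Formula.rhs φ) (Formula.type φ)

record _⇔ω_ {a : Level} (P : Set a) (Q : Setω) : Setω where
  field
    to   : P → Q
    from : Q → P

module Submission where

-- Soundness is an induction on deductions: every derivable equation comes with derivations
-- of its two sides whose interpretations agree, and coherence of a structure makes the
-- interpretation of a term independent of its derivation.
--
-- Completeness goes through the syntactic category: its objects are types, an arrow A → B
-- is a term of type B in the canonical context 0 … |A|-1 : A, taken up to provable equality;
-- composition is substitution and the tensor is juxtaposition after shifting variables.
-- Interpreting every atomic type by itself, each derivation of x : A ⊢ t : B denotes t with
-- every variable renamed to its position in x.  So the interpretation is coherent, every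
-- axiom holds, and an equation valid in this generic model is provable after renaming;
-- substituting x back for the positions recovers the equation itself.

open import Defs
open import Level using () renaming (zero to lzero)
open import Data.Bool using (true; false; T)
open import Data.Nat using (ℕ; zero; suc; _≡ᵇ_; _+_; _<_; _≤_; z≤n; s≤s; _≟_)
open import Data.Nat.Properties using (+-suc; +-identityʳ; +-assoc; suc-injective; <⇒≢; ≤-refl; +-cancelˡ-≡; ≤-trans; m≤m+n; <⇒≱; n≤1+n; m<m+n)
open import Data.Fin using (Fin; zero; suc; toℕ)
open import Data.Fin.Properties using (toℕ-injective; toℕ<n)
open import Data.Fin.Permutation using (Permutation′; _⟨$⟩ʳ_; _⟨$⟩ˡ_; inverseʳ; inverseˡ)
open import Data.List using (List; []; _∷_; _++_; length; tabulate; lookup; concat; map)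
open import Data.List.Properties using (length-++; length-map; length-tabulate; ++-assoc; ++-identityʳ; map-++)
open import Data.List.Membership.Propositional using (_∈_; _∉_)
open import Data.List.Membership.Propositional.Properties using (∈-++⁺ˡ; ∈-++⁺ʳ; ∈-++⁻; ∈-tabulate⁺)
open import Data.List.Relation.Unary.Any using (here; there)
open import Data.List.Relation.Unary.All as All using (All; []; _∷_)
open import Data.List.Relation.Unary.All.Properties as AllP using ()
open import Data.List.Relation.Unary.AllPairs as AllPairs using ([]; _∷_)
open import Data.List.Relation.Unary.Unique.Propositional using (Unique)
open import Data.List.Relation.Unary.Unique.Propositional.Properties using (tabulate⁺)
open import Data.Product using (Σ; _×_; _,_; proj₁; proj₂; ∃)
open import Data.Sum using (_⊎_; inj₁; inj₂)
open import Data.Empty using (⊥; ⊥-elim)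
open import Data.Unit using (⊤; tt)
open import Relation.Nullary using (yes; no)
open import Relation.Binary.Structures using (IsEquivalence)
open import Relation.Binary.PropositionalEquality using (_≡_; refl; cong; cong₂; subst; subst₂; _≢_)
import Relation.Binary.PropositionalEquality as ≡

≡ᵇ-refl : ∀ n → (n ≡ᵇ n) ≡ true
≡ᵇ-refl zero = refl
≡ᵇ-refl (suc n) = ≡ᵇ-refl n

≢⇒≡ᵇ-false : ∀ m n → m ≢ n → (m ≡ᵇ n) ≡ false
≢⇒≡ᵇ-false zero zero p = ⊥-elim (p refl)
≢⇒≡ᵇ-false zero (suc n) p = refl
≢⇒≡ᵇ-false (suc m) zero p = refl
≢⇒≡ᵇ-false (suc m) (suc n) p = ≢⇒≡ᵇ-false m n (λ q → p (cong suc q))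

∈-∷⁻ : ∀ {y z : ℕ} {ys} → z ∈ y ∷ ys → y ≢ z → z ∈ ys
∈-∷⁻ (here p) ne = ⊥-elim (ne (≡.sym p))
∈-∷⁻ (there m) ne = m

Unique-∷⇒≢ : ∀ {x z : ℕ} {xs} → Unique (x ∷ xs) → z ∈ xs → x ≢ z
Unique-∷⇒≢ (a ∷ _) m = All.lookup a m

Unique-++⁻ˡ : ∀ (p : List ℕ) {q} → Unique (p ++ q) → Unique p
Unique-++⁻ˡ [] u = []
Unique-++⁻ˡ (x ∷ p) (a ∷ u) = AllP.++⁻ˡ p a ∷ Unique-++⁻ˡ p u

Unique-++⁻ʳ : ∀ (p : List ℕ) {q} → Unique (p ++ q) → Unique q
Unique-++⁻ʳ [] u = u
Unique-++⁻ʳ (x ∷ p) (a ∷ u) = Unique-++⁻ʳ p u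

Unique-++⇒disjoint : ∀ (p : List ℕ) {q z} → Unique (p ++ q) → z ∈ p → z ∈ q → ⊥
Unique-++⇒disjoint (x ∷ p) (a ∷ u) (here refl) mq = All.lookup a (∈-++⁺ʳ p mq) refl
Unique-++⇒disjoint (x ∷ p) (a ∷ u) (there mp) mq = Unique-++⇒disjoint p u mp mq

All-drop-middle : ∀ {P : ℕ → Set} (p : List ℕ) {r s} → All P (p ++ r ++ s) → All P (p ++ s)
All-drop-middle [] {r} a = AllP.++⁻ʳ r a
All-drop-middle (x ∷ p) (a ∷ as) = a ∷ All-drop-middle p as

Unique-drop-middle : ∀ (p : List ℕ) {r s} → Unique (p ++ r ++ s) → Unique (p ++ s)
Unique-drop-middle [] {r} u = Unique-++⁻ʳ r u
Unique-drop-middle (x ∷ p) (a ∷ u) = All-drop-middle p a ∷ Unique-drop-middle p u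

range : ℕ → ℕ → List ℕ
range m zero = []
range m (suc n) = m ∷ range (suc m) n

length-range : ∀ m n → length (range m n) ≡ n
length-range m zero = refl
length-range m (suc n) = cong suc (length-range (suc m) n)

range-++ : ∀ m a b → range m (a + b) ≡ range m a ++ range (m + a) b
range-++ m zero b rewrite +-identityʳ m = refl
range-++ m (suc a) b rewrite +-suc m a = cong (m ∷_) (range-++ (suc m) a b)

∈-range⁻ : ∀ {z} m n → z ∈ range m n → m ≤ z × z < m + n
∈-range⁻ m zero ()
∈-range⁻ m (suc n) (here refl) = ≤-refl , subst (m <_) (≡.sym (+-suc m n)) (s≤s (m≤m+n m n))
∈-range⁻ {z} m (suc n) (there p) with ∈-range⁻ (suc m) n p
... | a , b = ≤-trans (n≤1+n m) a , subst (λ k → z < k) (≡.sym (+-suc m n)) b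

Unique-range : ∀ m n → Unique (range m n)
Unique-range m zero = []
Unique-range m (suc n) = All.tabulate (λ {z} mz eq → <⇒≢ (proj₁ (∈-range⁻ (suc m) n mz)) eq) ∷ Unique-range (suc m) n

module Substitution {F : Set} where
  At : Set
  At = Atom {F}
  Tm : Set
  Tm = RawTerm {F}
  Subst : Set
  Subst = ℕ → At

  mutual
    substAtomBy : Subst → At → At
    substAtomBy σ (var z) = σ z
    substAtomBy σ (app f ts) = app f (substTermsBy σ ts)

    substTermBy : Subst → Tm → Tm
    substTermBy σ [] = []
    substTermBy σ (a ∷ as) = substAtomBy σ a ∷ substTermBy σ as

    substTermsBy : Subst → List Tm → List Tm
    substTermsBy σ [] = []
    substTermsBy σ (t ∷ ts) = substTermBy σ t ∷ substTermsBy σ ts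

  mutual
    substAtom-substVar : ∀ ys ss a → substAtom ys ss a ≡ substAtomBy (substVar ys ss) a
    substAtom-substVar ys ss (var z) = refl
    substAtom-substVar ys ss (app f ts) = cong (app f) (substTerms-substVar ys ss ts)

    substTerm-substVar : ∀ ys ss t → substTerm ys ss t ≡ substTermBy (substVar ys ss) t
    substTerm-substVar ys ss [] = refl
    substTerm-substVar ys ss (a ∷ as) = cong₂ _∷_ (substAtom-substVar ys ss a) (substTerm-substVar ys ss as)

    substTerms-substVar : ∀ ys ss ts → substTerms ys ss ts ≡ substTermsBy (substVar ys ss) ts
    substTerms-substVar ys ss [] = refl
    substTerms-substVar ys ss (t ∷ ts) = cong₂ _∷_ (substTerm-substVar ys ss t) (substTerms-substVar ys ss ts)

  mutual
    AllVarsₐ : (ℕ → Set) → At → Set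
    AllVarsₐ P (var z) = P z
    AllVarsₐ P (app f ts) = AllVarsˢ P ts

    AllVars : (ℕ → Set) → Tm → Set
    AllVars P [] = ⊤
    AllVars P (a ∷ as) = AllVarsₐ P a × AllVars P as

    AllVarsˢ : (ℕ → Set) → List Tm → Set
    AllVarsˢ P [] = ⊤
    AllVarsˢ P (t ∷ ts) = AllVars P t × AllVarsˢ P ts

  mutual
    substAtomBy-cong : ∀ {σ τ : Subst} a → AllVarsₐ (λ z → σ z ≡ τ z) a → substAtomBy σ a ≡ substAtomBy τ a
    substAtomBy-cong (var z) p = p
    substAtomBy-cong (app f ts) p = cong (app f) (substTermsBy-cong ts p)

    substTermBy-cong : ∀ {σ τ : Subst} t → AllVars (λ z → σ z ≡ τ z) t → substTermBy σ t ≡ substTermBy τ t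
    substTermBy-cong [] _ = refl
    substTermBy-cong (a ∷ as) (p , q) = cong₂ _∷_ (substAtomBy-cong a p) (substTermBy-cong as q)

    substTermsBy-cong : ∀ {σ τ : Subst} ts → AllVarsˢ (λ z → σ z ≡ τ z) ts → substTermsBy σ ts ≡ substTermsBy τ ts
    substTermsBy-cong [] _ = refl
    substTermsBy-cong (t ∷ ts) (p , q) = cong₂ _∷_ (substTermBy-cong t p) (substTermsBy-cong ts q)

  mutual
    substAtomBy-∘ : ∀ (σ τ : Subst) a → substAtomBy σ (substAtomBy τ a) ≡ substAtomBy (λ z → substAtomBy σ (τ z)) a
    substAtomBy-∘ σ τ (var z) = refl
    substAtomBy-∘ σ τ (app f ts) = cong (app f) (substTermsBy-∘ σ τ ts)

    substTermBy-∘ : ∀ (σ τ : Subst) t → substTermBy σ (substTermBy τ t) ≡ substTermBy (λ z → substAtomBy σ (τ z)) t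
    substTermBy-∘ σ τ [] = refl
    substTermBy-∘ σ τ (a ∷ as) = cong₂ _∷_ (substAtomBy-∘ σ τ a) (substTermBy-∘ σ τ as)

    substTermsBy-∘ : ∀ (σ τ : Subst) ts → substTermsBy σ (substTermsBy τ ts) ≡ substTermsBy (λ z → substAtomBy σ (τ z)) ts
    substTermsBy-∘ σ τ [] = refl
    substTermsBy-∘ σ τ (t ∷ ts) = cong₂ _∷_ (substTermBy-∘ σ τ t) (substTermsBy-∘ σ τ ts)

  mutual
    substAtomBy-var : ∀ a → substAtomBy var a ≡ a
    substAtomBy-var (var z) = refl
    substAtomBy-var (app f ts) = cong (app f) (substTermsBy-var ts)

    substTermBy-var : ∀ t → substTermBy var t ≡ t
    substTermBy-var [] = refl
    substTermBy-var (a ∷ as) = cong₂ _∷_ (substAtomBy-var a) (substTermBy-var as)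

    substTermsBy-var : ∀ ts → substTermsBy var ts ≡ ts
    substTermsBy-var [] = refl
    substTermsBy-var (t ∷ ts) = cong₂ _∷_ (substTermBy-var t) (substTermsBy-var ts)

  mutual
    AllVarsₐ-mono : ∀ {P Q : ℕ → Set} → (∀ {z} → P z → Q z) → ∀ a → AllVarsₐ P a → AllVarsₐ Q a
    AllVarsₐ-mono f (var z) p = f p
    AllVarsₐ-mono f (app g ts) p = AllVarsˢ-mono f ts p

    AllVars-mono : ∀ {P Q : ℕ → Set} → (∀ {z} → P z → Q z) → ∀ t → AllVars P t → AllVars Q t
    AllVars-mono f [] p = tt
    AllVars-mono f (a ∷ as) (p , q) = AllVarsₐ-mono f a p , AllVars-mono f as q

    AllVarsˢ-mono : ∀ {P Q : ℕ → Set} → (∀ {z} → P z → Q z) → ∀ ts → AllVarsˢ P ts → AllVarsˢ Q ts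
    AllVarsˢ-mono f [] p = tt
    AllVarsˢ-mono f (t ∷ ts) (p , q) = AllVars-mono f t p , AllVarsˢ-mono f ts q

  mutual
    AllVarsₐ-universal : ∀ {P : ℕ → Set} → (∀ z → P z) → ∀ a → AllVarsₐ P a
    AllVarsₐ-universal f (var z) = f z
    AllVarsₐ-universal f (app g ts) = AllVarsˢ-universal f ts

    AllVars-universal : ∀ {P : ℕ → Set} → (∀ z → P z) → ∀ t → AllVars P t
    AllVars-universal f [] = tt
    AllVars-universal f (a ∷ as) = AllVarsₐ-universal f a , AllVars-universal f as

    AllVarsˢ-universal : ∀ {P : ℕ → Set} → (∀ z → P z) → ∀ ts → AllVarsˢ P ts
    AllVarsˢ-universal f [] = tt
    AllVarsˢ-universal f (t ∷ ts) = AllVars-universal f t , AllVarsˢ-universal f ts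

  mutual
    AllVarsₐ-substAtomBy : ∀ {P : ℕ → Set} (σ : Subst) a → AllVarsₐ (λ z → AllVarsₐ P (σ z)) a → AllVarsₐ P (substAtomBy σ a)
    AllVarsₐ-substAtomBy σ (var z) p = p
    AllVarsₐ-substAtomBy σ (app f ts) p = AllVarsˢ-substTermsBy σ ts p

    AllVars-substTermBy : ∀ {P : ℕ → Set} (σ : Subst) t → AllVars (λ z → AllVarsₐ P (σ z)) t → AllVars P (substTermBy σ t)
    AllVars-substTermBy σ [] p = tt
    AllVars-substTermBy σ (a ∷ as) (p , q) = AllVarsₐ-substAtomBy σ a p , AllVars-substTermBy σ as q

    AllVarsˢ-substTermsBy : ∀ {P : ℕ → Set} (σ : Subst) ts → AllVarsˢ (λ z → AllVarsₐ P (σ z)) ts → AllVarsˢ P (substTermsBy σ ts)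
    AllVarsˢ-substTermsBy σ [] p = tt
    AllVarsˢ-substTermsBy σ (t ∷ ts) (p , q) = AllVars-substTermBy σ t p , AllVarsˢ-substTermsBy σ ts q

  length-substTermBy : ∀ (σ : Subst) t → length (substTermBy σ t) ≡ length t
  length-substTermBy σ [] = refl
  length-substTermBy σ (a ∷ t) = cong suc (length-substTermBy σ t)

  substTermBy-++ : ∀ (σ : Subst) s t → substTermBy σ (s ++ t) ≡ substTermBy σ s ++ substTermBy σ t
  substTermBy-++ σ [] t = refl
  substTermBy-++ σ (a ∷ s) t = cong (substAtomBy σ a ∷_) (substTermBy-++ σ s t)

  AllVars-++⁺ : ∀ {P} s {t} → AllVars P s → AllVars P t → AllVars P (s ++ t)
  AllVars-++⁺ [] p q = q
  AllVars-++⁺ (a ∷ s) (p , p') q = p , AllVars-++⁺ s p' q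

  AllVars-map-var : ∀ {P : ℕ → Set} (ys : List ℕ) → (∀ {z} → z ∈ ys → P z) → AllVars P (map var ys)
  AllVars-map-var [] f = tt
  AllVars-map-var (y ∷ ys) f = f (here refl) , AllVars-map-var ys (λ m → f (there m))

  substVar-here : ∀ y ys (s : At) ss → substVar (y ∷ ys) (s ∷ ss) y ≡ s
  substVar-here y ys s ss rewrite ≡ᵇ-refl y = refl

  substVar-there : ∀ {y z} ys (s : At) ss → y ≢ z → substVar (y ∷ ys) (s ∷ ss) z ≡ substVar ys ss z
  substVar-there {y} {z} ys s ss p rewrite ≢⇒≡ᵇ-false y z p = refl

  substVar-∉ : ∀ {z} ys (ss : Tm) → z ∉ ys → substVar ys ss z ≡ var z
  substVar-∉ [] ss _ = refl
  substVar-∉ (y ∷ ys) [] _ = refl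
  substVar-∉ {z} (y ∷ ys) (s ∷ ss) p =
    ≡.trans (substVar-there ys s ss (λ q → p (here (≡.sym q)))) (substVar-∉ ys ss (λ q → p (there q)))

  substVar-substTermBy : ∀ {z} (σ : Subst) ys ss → z ∈ ys → length ys ≡ length ss →
      substVar ys (substTermBy σ ss) z ≡ substAtomBy σ (substVar ys ss z)
  substVar-substTermBy σ [] [] () _
  substVar-substTermBy σ (y ∷ ys) [] m ()
  substVar-substTermBy σ [] (s ∷ ss) () _
  substVar-substTermBy {z} σ (y ∷ ys) (s ∷ ss) m l with y ≟ z
  ... | yes refl = ≡.trans (substVar-here y ys (substAtomBy σ s) (substTermBy σ ss)) (cong (substAtomBy σ) (≡.sym (substVar-here y ys s ss)))
  ... | no ne = ≡.trans (substVar-there ys _ _ ne)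
                  (≡.trans (substVar-substTermBy σ ys ss (∈-∷⁻ m ne) (suc-injective l))
                          (cong (substAtomBy σ) (≡.sym (substVar-there ys s ss ne))))

  substVar-++ˡ : ∀ {z} ys ys' (ss ss' : Tm) → z ∈ ys → length ys ≡ length ss →
      substVar (ys ++ ys') (ss ++ ss') z ≡ substVar ys ss z
  substVar-++ˡ [] ys' [] ss' () _
  substVar-++ˡ (y ∷ ys) ys' [] ss' m ()
  substVar-++ˡ [] ys' (s ∷ ss) ss' () _
  substVar-++ˡ {z} (y ∷ ys) ys' (s ∷ ss) ss' m l with y ≟ z
  ... | yes refl = ≡.trans (substVar-here y (ys ++ ys') s (ss ++ ss')) (≡.sym (substVar-here y ys s ss))
  ... | no ne = ≡.trans (substVar-there (ys ++ ys') s (ss ++ ss') ne)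
                  (≡.trans (substVar-++ˡ ys ys' ss ss' (∈-∷⁻ m ne) (suc-injective l)) (≡.sym (substVar-there ys s ss ne)))

  substVar-++ʳ : ∀ {z} ys ys' (ss ss' : Tm) → z ∉ ys → length ys ≡ length ss →
      substVar (ys ++ ys') (ss ++ ss') z ≡ substVar ys' ss' z
  substVar-++ʳ [] ys' [] ss' m _ = refl
  substVar-++ʳ (y ∷ ys) ys' [] ss' m ()
  substVar-++ʳ [] ys' (s ∷ ss) ss' m ()
  substVar-++ʳ {z} (y ∷ ys) ys' (s ∷ ss) ss' m l =
    ≡.trans (substVar-there (ys ++ ys') s (ss ++ ss') (λ q → m (here (≡.sym q))))
           (substVar-++ʳ ys ys' ss ss' (λ q → m (there q)) (suc-injective l))

  substVar-AllVars : ∀ {z} {P : ℕ → Set} ys (ss : Tm) → z ∈ ys → length ys ≡ length ss → AllVars P ss →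
      AllVarsₐ P (substVar ys ss z)
  substVar-AllVars [] [] () _ _
  substVar-AllVars (y ∷ ys) [] m () _
  substVar-AllVars [] (s ∷ ss) () _ _
  substVar-AllVars {z} (y ∷ ys) (s ∷ ss) m l (p , q) with y ≟ z
  ... | yes refl = subst (AllVarsₐ _) (≡.sym (substVar-here y ys s ss)) p
  ... | no ne = subst (AllVarsₐ _) (≡.sym (substVar-there ys s ss ne)) (substVar-AllVars ys ss (∈-∷⁻ m ne) (suc-injective l) q)

  substVar-self : ∀ ys z → substVar ys (map var ys) z ≡ var z
  substVar-self [] z = refl
  substVar-self (y ∷ ys) z with y ≟ z
  ... | yes refl = substVar-here y ys (var y) _
  ... | no ne = ≡.trans (substVar-there ys _ _ ne) (substVar-self ys z)

  substTermBy-substVar-self : ∀ ys t → substTermBy (substVar ys (map var ys)) t ≡ t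
  substTermBy-substVar-self ys t = ≡.trans (substTermBy-cong t (AllVars-universal (substVar-self ys) t)) (substTermBy-var t)

  substTermBy-substVar-vars : ∀ ys (u : Tm) → Unique ys → length u ≡ length ys → substTermBy (substVar ys u) (map var ys) ≡ u
  substTermBy-substVar-vars [] [] _ _ = refl
  substTermBy-substVar-vars [] (x ∷ u) _ ()
  substTermBy-substVar-vars (y ∷ ys) [] _ ()
  substTermBy-substVar-vars (y ∷ ys) (u₀ ∷ u) uq l =
    cong₂ _∷_ (substVar-here y ys u₀ u)
      (≡.trans (substTermBy-cong (map var ys) (AllVars-map-var ys (λ m → substVar-there ys u₀ u (Unique-∷⇒≢ uq m))))
              (substTermBy-substVar-vars ys u (AllPairs.tail uq) (suc-injective l)))

  substVar-rename : ∀ {z} w ys (u : Tm) → Unique w → z ∈ ys → length ys ≡ length w → length u ≡ length w →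
      substAtomBy (substVar w u) (substVar ys (map var w) z) ≡ substVar ys u z
  substVar-rename w ys u uq m l1 l2 =
    ≡.trans (≡.sym (substVar-substTermBy (substVar w u) ys (map var w) m (≡.trans l1 (≡.sym (length-map var w)))))
           (cong (λ v → substVar ys v _) (substTermBy-substVar-vars w u uq l2))

  rangeTerm : ℕ → ℕ → Tm
  rangeTerm m n = map var (range m n)

  length-rangeTerm : ∀ m n → length (rangeTerm m n) ≡ n
  length-rangeTerm m n = ≡.trans (length-map var (range m n)) (length-range m n)

  rangeTerm-++ : ∀ m a b → rangeTerm m (a + b) ≡ rangeTerm m a ++ rangeTerm (m + a) b
  rangeTerm-++ m a b rewrite range-++ m a b = map-++ var (range m a) _

  shift : ℕ → Subst
  shift j z = var (j + z)

  shift-rangeTerm : ∀ j m n → substTermBy (shift j) (rangeTerm m n) ≡ rangeTerm (j + m) n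
  shift-rangeTerm j m zero = refl
  shift-rangeTerm j m (suc n) rewrite ≡.sym (+-suc j m) = cong (var (j + m) ∷_) (shift-rangeTerm j (suc m) n)

  shift-rangeTerm₀ : ∀ j n → substTermBy (shift j) (rangeTerm 0 n) ≡ rangeTerm j n
  shift-rangeTerm₀ j n = ≡.trans (shift-rangeTerm j 0 n) (cong (λ k → rangeTerm k n) (+-identityʳ j))

  shift-shift : ∀ a b t → substTermBy (shift a) (substTermBy (shift b) t) ≡ substTermBy (shift (a + b)) t
  shift-shift a b t = ≡.trans (substTermBy-∘ (shift a) (shift b) t) (substTermBy-cong t (AllVars-universal (λ z → cong var (≡.sym (+-assoc a b z))) t))

  substVar-range-shift : ∀ {z} j m n (u : Tm) → z ∈ range m n → n ≡ length u →
      substVar (range m n) u z ≡ substVar (range (j + m) n) u (j + z)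
  substVar-range-shift j m zero u () _
  substVar-range-shift j m (suc n) [] mem ()
  substVar-range-shift {z} j m (suc n) (u₀ ∷ u) mem l with m ≟ z
  ... | yes refl = ≡.trans (substVar-here m (range (suc m) n) u₀ u) (≡.sym (substVar-here (j + m) (range (suc (j + m)) n) u₀ u))
  ... | no ne = ≡.trans (substVar-there (range (suc m) n) u₀ u ne)
                  (≡.trans (substVar-range-shift j (suc m) n u (∈-∷⁻ mem ne) (suc-injective l))
                     (≡.trans (cong (λ k → substVar (range k n) u (j + z)) (+-suc j m))
                        (≡.sym (substVar-there (range (suc (j + m)) n) u₀ u (λ q → ne (+-cancelˡ-≡ j m z q))))))

  -- Outside the list the value var 0 is junk; it is only used at indices below the length.
  lookupAtom : Tm → ℕ → At
  lookupAtom [] k = var 0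
  lookupAtom (a ∷ u) zero = a
  lookupAtom (a ∷ u) (suc k) = lookupAtom u k

  substVar-range-lookup : ∀ m n k (u : Tm) → k < n → length u ≡ n → substVar (range m n) u (m + k) ≡ lookupAtom u k
  substVar-range-lookup m (suc n) zero (u₀ ∷ u) lt l rewrite +-identityʳ m = substVar-here m (range (suc m) n) u₀ u
  substVar-range-lookup m (suc n) (suc k) (u₀ ∷ u) (s≤s lt) l =
    ≡.trans (substVar-there {m} {m + suc k} (range (suc m) n) u₀ u (<⇒≢ (m<m+n m (s≤s z≤n))))
      (≡.trans (cong (substVar (range (suc m) n) u) (+-suc m k)) (substVar-range-lookup (suc m) n k u lt (suc-injective l)))
  substVar-range-lookup m zero k u () l
  substVar-range-lookup m (suc n) k [] lt ()

  lookupAtom-rangeTerm : ∀ m n k → k < n → lookupAtom (rangeTerm m n) k ≡ var (m + k)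
  lookupAtom-rangeTerm m (suc n) zero lt rewrite +-identityʳ m = refl
  lookupAtom-rangeTerm m (suc n) (suc k) (s≤s lt) rewrite +-suc m k = lookupAtom-rangeTerm (suc m) n k lt

  plug : ℕ → Tm → Subst
  plug n u = substVar (range 0 n) u

  substVar-range-rangeTerm : ∀ {z} a c → z ∈ range 0 c → substVar (range 0 c) (rangeTerm a c) z ≡ var (a + z)
  substVar-range-rangeTerm {z} a c m = ≡.trans (substVar-range-shift a 0 c (rangeTerm a c) m (≡.sym (length-rangeTerm a c))) (h (a + 0) (+-identityʳ a))
    where
    h : ∀ k → k ≡ a → substVar (range k c) (rangeTerm a c) (a + z) ≡ var (a + z)
    h k refl = substVar-self (range k c) (a + z)

  +-∉-range : ∀ y z → y + z ∉ range 0 y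
  +-∉-range y z m = <⇒≱ (proj₂ (∈-range⁻ 0 y m)) (m≤m+n y z)

  singletons : Tm → List Tm
  singletons [] = []
  singletons (a ∷ u) = (a ∷ []) ∷ singletons u

  plug-slice : ∀ m n N (p q r : Tm) → length p ≡ m → length q ≡ n → N ≡ m + (n + length r) →
      substTermBy (plug N (p ++ q ++ r)) (rangeTerm m n) ≡ q
  plug-slice m n N p q r refl refl refl =
    ≡.trans (substTermBy-cong (rangeTerm (length p) (length q)) (AllVars-map-var (range (length p) (length q)) inSlice))
      (substTermBy-substVar-vars (range (length p) (length q)) q (Unique-range _ _) (≡.sym (length-range _ _)))
    where
    inSlice : ∀ {z} → z ∈ range (length p) (length q) →
        plug (length p + (length q + length r)) (p ++ q ++ r) z ≡ substVar (range (length p) (length q)) q z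
    inSlice {z} mz =
      ≡.trans (cong (λ l → substVar l (p ++ q ++ r) z)
                (≡.trans (range-++ 0 (length p) _) (cong (range 0 (length p) ++_) (range-++ (length p) (length q) (length r)))))
        (≡.trans (substVar-++ʳ (range 0 (length p)) _ p _ (λ m′ → <⇒≱ (proj₂ (∈-range⁻ 0 _ m′)) (proj₁ (∈-range⁻ _ _ mz))) (length-range 0 _))
          (substVar-++ˡ (range (length p) (length q)) _ q r mz (length-range _ _)))

  plug-singletons : ∀ m n (u : Tm) → length u ≡ n → substTermsBy (substVar (range m n) u) (singletons (rangeTerm m n)) ≡ singletons u
  plug-singletons m zero [] l = refl
  plug-singletons m zero (x ∷ u) ()
  plug-singletons m (suc n) [] ()
  plug-singletons m (suc n) (u₀ ∷ u) l =
    cong₂ _∷_ (cong (_∷ []) (substVar-here m (range (suc m) n) u₀ u))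
      (≡.trans (substTermsBy-cong (singletons (rangeTerm (suc m) n))
                 (AllVarsˢ-singletons (range (suc m) n) (λ mz → substVar-there (range (suc m) n) u₀ u (<⇒≢ (proj₁ (∈-range⁻ (suc m) n mz))))))
        (plug-singletons (suc m) n u (suc-injective l)))
    where
    AllVarsˢ-singletons : ∀ {P : ℕ → Set} ys → (∀ {z} → z ∈ ys → P z) → AllVarsˢ P (singletons (map var ys))
    AllVarsˢ-singletons [] f = tt
    AllVarsˢ-singletons (y ∷ ys) f = (f (here refl) , tt) , AllVarsˢ-singletons ys (λ mz → f (there mz))

  singletons-concat : ∀ (ts : List Tm) → All (λ t → length t ≡ 1) ts → singletons (concat ts) ≡ ts
  singletons-concat [] _ = refl
  singletons-concat ((a ∷ []) ∷ ts) (_ ∷ ps) = cong ((a ∷ []) ∷_) (singletons-concat ts ps)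
  singletons-concat ([] ∷ ts) (() ∷ ps)
  singletons-concat ((a ∷ b ∷ t) ∷ ts) (() ∷ ps)

  substTermBy-concat : ∀ (σ : Subst) (ts : List Tm) → substTermBy σ (concat ts) ≡ concat (substTermsBy σ ts)
  substTermBy-concat σ [] = refl
  substTermBy-concat σ (t ∷ ts) = ≡.trans (substTermBy-++ σ t (concat ts)) (cong (substTermBy σ t ++_) (substTermBy-concat σ ts))

  lookupAtom-varTerm : ∀ {X : Set} {A : List X} (x : Vars A) j → lookupAtom (varTerm x) (toℕ j) ≡ var (lookupᵛ x j)
  lookupAtom-varTerm (z ∷ x) zero = refl
  lookupAtom-varTerm (z ∷ x) (suc j) = lookupAtom-varTerm x j

module VarsProperties {X : Set} where
  varList-++ : ∀ {A B : List X} (x : Vars A) (y : Vars B) → varList (x ++ᵛ y) ≡ varList x ++ varList y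
  varList-++ [] y = refl
  varList-++ (z ∷ x) y = cong (z ∷_) (varList-++ x y)

  varList-++₃ : ∀ {A B C : List X} (x : Vars A) (y : Vars B) (w : Vars C) →
      varList (x ++ᵛ y ++ᵛ w) ≡ varList x ++ varList y ++ varList w
  varList-++₃ x y w = ≡.trans (varList-++ x _) (cong (varList x ++_) (varList-++ y w))

  varList-++₄ : ∀ {A B C E : List X} (x : Vars A) (y : Vars B) (w : Vars C) (v : Vars E) →
      varList (x ++ᵛ y ++ᵛ w ++ᵛ v) ≡ varList x ++ varList y ++ varList w ++ varList v
  varList-++₄ x y w v = ≡.trans (varList-++ x _) (cong (varList x ++_) (varList-++₃ y w v))

  length-varList : ∀ {A : List X} (x : Vars A) → length (varList x) ≡ length A
  length-varList [] = refl
  length-varList (z ∷ x) = cong suc (length-varList x)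

  varTerm-map : ∀ {F : Set} {A : List X} (x : Vars A) → varTerm {F} x ≡ map var (varList x)
  varTerm-map [] = refl
  varTerm-map (z ∷ x) = cong (var z ∷_) (varTerm-map x)

  length-varTerm : ∀ {F : Set} {A : List X} (x : Vars A) → length (varTerm {F} x) ≡ length A
  length-varTerm [] = refl
  length-varTerm (z ∷ x) = cong suc (length-varTerm x)

  lookupᵛ-∈ : ∀ {A : List X} (x : Vars A) i → lookupᵛ x i ∈ varList x
  lookupᵛ-∈ (z ∷ x) zero = here refl
  lookupᵛ-∈ (z ∷ x) (suc i) = there (lookupᵛ-∈ x i)

  ∈⇒lookupᵛ : ∀ {A : List X} {z} (x : Vars A) → z ∈ varList x → ∃ λ i → z ≡ lookupᵛ x i
  ∈⇒lookupᵛ (y ∷ x) (here p) = zero , p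
  ∈⇒lookupᵛ (y ∷ x) (there m) with ∈⇒lookupᵛ x m
  ... | i , p = suc i , p

  lookupᵛ-injective : ∀ {A : List X} (x : Vars A) → Unique (varList x) → ∀ {i j} → lookupᵛ x i ≡ lookupᵛ x j → i ≡ j
  lookupᵛ-injective (z ∷ x) u {zero} {zero} p = refl
  lookupᵛ-injective (z ∷ x) u {zero} {suc j} p = ⊥-elim (Unique-∷⇒≢ u (lookupᵛ-∈ x j) p)
  lookupᵛ-injective (z ∷ x) u {suc i} {zero} p = ⊥-elim (Unique-∷⇒≢ u (lookupᵛ-∈ x i) (≡.sym p))
  lookupᵛ-injective (z ∷ x) u {suc i} {suc j} p = cong suc (lookupᵛ-injective x (AllPairs.tail u) p)

  varList-tabulateᵛ : ∀ {n} (f : Fin n → X) (g : Fin n → ℕ) → varList (tabulateᵛ f g) ≡ tabulate g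
  varList-tabulateᵛ {zero} f g = refl
  varList-tabulateᵛ {suc n} f g = cong (g zero ∷_) (varList-tabulateᵛ (λ i → f (suc i)) (λ i → g (suc i)))


  tabulateVars : (A : List X) → (Fin (length A) → ℕ) → Vars A
  tabulateVars [] g = []
  tabulateVars (a ∷ A) g = g zero ∷ tabulateVars A (λ i → g (suc i))

  lookupᵛ-tabulateVars : ∀ (A : List X) g i → lookupᵛ (tabulateVars A g) i ≡ g i
  lookupᵛ-tabulateVars (a ∷ A) g zero = refl
  lookupᵛ-tabulateVars (a ∷ A) g (suc i) = lookupᵛ-tabulateVars A (λ i → g (suc i)) i

  varList-tabulateVars : ∀ (A : List X) g → varList (tabulateVars A g) ≡ tabulate g
  varList-tabulateVars [] g = refl
  varList-tabulateVars (a ∷ A) g = cong (g zero ∷_) (varList-tabulateVars A (λ i → g (suc i)))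

  module _ {F : Set} where
    open Substitution {F}
    substVar-lookupᵛ : ∀ {A : List X} (y : Vars A) (u : Tm) → Unique (varList y) → length u ≡ length A → ∀ j →
        substVar (varList y) u (lookupᵛ y j) ≡ lookupAtom u (toℕ j)
    substVar-lookupᵛ (z ∷ y) [] uq () j
    substVar-lookupᵛ (z ∷ y) (u₀ ∷ u) uq l zero = substVar-here z (varList y) u₀ u
    substVar-lookupᵛ (z ∷ y) (u₀ ∷ u) uq l (suc j) =
      ≡.trans (substVar-there (varList y) u₀ u (Unique-∷⇒≢ uq (lookupᵛ-∈ y j))) (substVar-lookupᵛ y u (AllPairs.tail uq) (suc-injective l) j)

    substVar-tabulate : ∀ {n} (h : Fin n → ℕ) (u : Tm) → Unique (tabulate h) → length u ≡ n → ∀ i →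
        substVar (tabulate h) u (h i) ≡ lookupAtom u (toℕ i)
    substVar-tabulate {zero} h u uq l ()
    substVar-tabulate {suc n} h [] uq () i
    substVar-tabulate {suc n} h (u₀ ∷ u) uq l zero = substVar-here (h zero) (tabulate (λ i → h (suc i))) u₀ u
    substVar-tabulate {suc n} h (u₀ ∷ u) uq l (suc i) =
      ≡.trans (substVar-there (tabulate (λ i → h (suc i))) u₀ u (Unique-∷⇒≢ uq (∈-tabulate⁺ i)))
             (substVar-tabulate (λ i → h (suc i)) u (AllPairs.tail uq) (suc-injective l) i)

module Derivations (L : Language) where
  open Language L
  open Substitution {Fun}
  open VarsProperties {Sort}
  open import Data.List.Membership.DecPropositional _≟_ using (_∈?_)

  Der : ∀ {A : List Sort} → Vars A → Term L → List Sort → Set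
  Der x t B = _⊢_∶_ L x t B

  castTerm : ∀ {A B} {x : Vars A} {t t'} → t ≡ t' → Der x t B → Der x t' B
  castTerm refl d = d

  castCtx : ∀ {A B} {x x' : Vars A} {t} → x ≡ x' → Der x t B → Der x' t B
  castCtx refl d = d

  varTerm-der : ∀ {A} (x : Vars A) → Distinct L x → Der x (varTerm x) A
  varTerm-der [] u = empty
  varTerm-der {a ∷ A} (z ∷ x) u = tens (var z a) (varTerm-der x (AllPairs.tail u)) u

  length-der : ∀ {A B} {x : Vars A} {t} → Der x t B → length t ≡ length B
  length-der (var x a) = refl
  length-der (fun f args u) = refl
  length-der (sub {y = y} {s} {t} d₁ d₂) = ≡.trans (cong length (substTerm-substVar (varList y) s t)) (≡.trans (length-substTermBy _ t) (length-der d₂))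
  length-der empty = refl
  length-der (tens {B = B} {s = s} {t} d₁ d₂ u) = ≡.trans (length-++ s) (≡.trans (cong₂ _+_ (length-der d₁) (length-der d₂)) (≡.sym (length-++ B)))
  length-der (weak w d u) = length-der d
  length-der (exch e σ d) = length-der d
  length-der (contr c {x = x} {x′} {t = t} d) =
    ≡.trans (cong length (substTerm-substVar (varList x′) (varTerm x) t)) (≡.trans (length-substTermBy _ t) (length-der d))

  distinct-der : ∀ {A B} {x : Vars A} {t} → Der x t B → Distinct L x
  distinct-der (var x a) = [] ∷ []
  distinct-der (fun f args u) = u
  distinct-der (sub d₁ d₂) = distinct-der d₁
  distinct-der empty = []
  distinct-der (tens d₁ d₂ u) = u
  distinct-der (weak w d u) = u
  distinct-der (exch e {A} {x = x} σ d) =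
    subst Unique (≡.sym (varList-tabulateᵛ (λ i → lookup A (σ ⟨$⟩ʳ i)) (λ i → lookupᵛ x (σ ⟨$⟩ʳ i))))
      (tabulate⁺ λ {i} {j} p →
        ≡.trans (≡.sym (inverseˡ σ)) (≡.trans (cong (σ ⟨$⟩ˡ_) (lookupᵛ-injective x (distinct-der d) p)) (inverseˡ σ)))
  distinct-der (contr c {x₁ = x₁} {x} {x′} {x₂} d) =
    subst Unique (≡.sym (varList-++₃ x₁ x x₂)) (subst Unique (++-assoc (varList x₁) (varList x) (varList x₂))
      (Unique-drop-middle (varList x₁ ++ varList x) {varList x′} {varList x₂}
        (subst Unique (≡.sym (++-assoc (varList x₁) (varList x) _)) (subst Unique (varList-++₄ x₁ x x′ x₂) (distinct-der d)))))

  ∈-++ᵛˡ : ∀ {A B z} (x : Vars A) (y : Vars B) → z ∈ varList x → z ∈ varList (x ++ᵛ y)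
  ∈-++ᵛˡ x y m = subst (_ ∈_) (≡.sym (varList-++ x y)) (∈-++⁺ˡ m)

  ∈-++ᵛʳ : ∀ {A B z} (x : Vars A) (y : Vars B) → z ∈ varList y → z ∈ varList (x ++ᵛ y)
  ∈-++ᵛʳ x y m = subst (_ ∈_) (≡.sym (varList-++ x y)) (∈-++⁺ʳ (varList x) m)

  ∈-++ᵛ⁻ : ∀ {A B z} (x : Vars A) (y : Vars B) → z ∈ varList (x ++ᵛ y) → z ∈ varList x ⊎ z ∈ varList y
  ∈-++ᵛ⁻ x y m = ∈-++⁻ (varList x) (subst (_ ∈_) (varList-++ x y) m)

  mutual
    vars-der : ∀ {A B} {x : Vars A} {t} → Der x t B → AllVars (_∈ varList x) t
    vars-der (var x a) = here refl , tt
    vars-der (fun f args u) = vars-args args , tt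
    vars-der (sub {x = x} {y} {s} {t} d₁ d₂) =
      subst (AllVars (_∈ varList x)) (≡.sym (substTerm-substVar (varList y) s t))
        (AllVars-substTermBy (substVar (varList y) s) t
          (AllVars-mono (λ m → substVar-AllVars (varList y) s m (≡.trans (length-varList y) (≡.sym (length-der d₁))) (vars-der d₁)) t (vars-der d₂)))
    vars-der empty = tt
    vars-der (tens {x = x} {y} {s} {t} d₁ d₂ u) =
      AllVars-++⁺ s (AllVars-mono (∈-++ᵛˡ x y) s (vars-der d₁)) (AllVars-mono (∈-++ᵛʳ x y) t (vars-der d₂))
    vars-der (weak w {x₁ = x₁} {x₂} {x₃} {t} d u) = AllVars-mono weaken t (vars-der d)
      where
      weaken : ∀ {z} → z ∈ varList (x₁ ++ᵛ x₃) → z ∈ varList (x₁ ++ᵛ x₂ ++ᵛ x₃)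
      weaken m with ∈-++ᵛ⁻ x₁ x₃ m
      ... | inj₁ m₁ = ∈-++ᵛˡ x₁ _ m₁
      ... | inj₂ m₃ = ∈-++ᵛʳ x₁ _ (∈-++ᵛʳ x₂ x₃ m₃)
    vars-der (exch e {A} {x = x} {t = t} σ d) = AllVars-mono permute∈ t (vars-der d)
      where
      permute∈ : ∀ {z} → z ∈ varList x → z ∈ varList (permuteᵛ x σ)
      permute∈ m with ∈⇒lookupᵛ x m
      ... | j , refl = subst (_ ∈_) (≡.sym (varList-tabulateᵛ (λ i → lookup A (σ ⟨$⟩ʳ i)) (λ i → lookupᵛ x (σ ⟨$⟩ʳ i))))
                         (subst (_∈ tabulate (λ i → lookupᵛ x (σ ⟨$⟩ʳ i))) (cong (lookupᵛ x) (inverseʳ σ))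
                           (∈-tabulate⁺ (σ ⟨$⟩ˡ j)))
    vars-der (contr c {x₁ = x₁} {x} {x′} {x₂} {t} d) =
      subst (AllVars (_∈ varList (x₁ ++ᵛ x ++ᵛ x₂))) (≡.sym (substTerm-substVar (varList x′) (varTerm x) t))
        (AllVars-substTermBy (substVar (varList x′) (varTerm x)) t (AllVars-mono contract t (vars-der d)))
      where
      P : ℕ → Set
      P = _∈ varList (x₁ ++ᵛ x ++ᵛ x₂)
      contract : ∀ {z} → z ∈ varList (x₁ ++ᵛ x ++ᵛ x′ ++ᵛ x₂) → AllVarsₐ P (substVar (varList x′) (varTerm x) z)
      contract {z} m with z ∈? varList x′
      ... | yes m′ = substVar-AllVars (varList x′) (varTerm x) m′
                       (≡.trans (length-varList x′) (≡.sym (length-varTerm x)))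
                       (subst (AllVars P) (≡.sym (varTerm-map x)) (AllVars-map-var (varList x) (λ q → ∈-++ᵛʳ x₁ _ (∈-++ᵛˡ x x₂ q))))
      ... | no n′ = subst (AllVarsₐ P) (≡.sym (substVar-∉ (varList x′) (varTerm x) n′)) kept
        where
        kept : P z
        kept with ∈-++ᵛ⁻ x₁ _ m
        ... | inj₁ m₁ = ∈-++ᵛˡ x₁ _ m₁
        ... | inj₂ m' with ∈-++ᵛ⁻ x _ m'
        ... | inj₁ m₂ = ∈-++ᵛʳ x₁ _ (∈-++ᵛˡ x x₂ m₂)
        ... | inj₂ m'' with ∈-++ᵛ⁻ x′ _ m''
        ... | inj₁ m₃ = ⊥-elim (n′ m₃)
        ... | inj₂ m₄ = ∈-++ᵛʳ x₁ _ (∈-++ᵛʳ x x₂ m₄)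

    vars-args : ∀ {A bs} {x : Vars A} {ts} → Args L x ts bs → AllVarsˢ (_∈ varList x) ts
    vars-args [] = tt
    vars-args (_∷_ {x = x} {xs} {t} {ts} d args) =
      AllVars-mono (∈-++ᵛˡ x xs) t (vars-der d) , AllVarsˢ-mono (∈-++ᵛʳ x xs) ts (vars-args args)

  length-args : ∀ (σ : Subst) {A bs} {x : Vars A} {ts} → Args L x ts bs → All (λ t → length t ≡ 1) (substTermsBy σ ts)
  length-args σ [] = []
  length-args σ (_∷_ {t = t} d args) = ≡.trans (length-substTermBy σ t) (length-der d) ∷ length-args σ args

-- Soundness

module Soundness {L : Language} (𝕋 : Theory L) {o ℓ e} (𝐂 : MonoidalCategory o ℓ e) (M : Model 𝐂 𝕋) where
  open Language L
  open Derivations L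
  open MonoidalCategory 𝐂
  open Structure (Model.structure M)
  open Interp 𝐂 L prestructure
  private module ≈ {X Y} = IsEquivalence (≈-equiv {X} {Y})

  EqualInterpretations : ∀ {A} → Vars A → Term L → Term L → List Sort → Set e
  EqualInterpretations x s t B = Σ (Der x s B) λ d → Σ (Der x t B) λ d′ → ⟦ d ⟧d ≈ ⟦ d′ ⟧d

  -- Coherence of M is used only to compare two derivations of one term (in transitivity, and for φ in sound).
  thm⇒equalInterpretations : ∀ {A B} {x : Vars A} {s t} → Thm 𝕋 x s t B → EqualInterpretations x s t B
  thm⇒equalInterpretations (ax φ a) = Formula.lhsTerm φ , Formula.rhsTerm φ , Model.satisfies M φ a
  thm⇒equalInterpretations (refl d) = d , d , ≈.refl
  thm⇒equalInterpretations (sym p) =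
    let d , d′ , eq = thm⇒equalInterpretations p in d′ , d , ≈.sym eq
  thm⇒equalInterpretations (trans p q) =
    let d , d₁ , eq = thm⇒equalInterpretations p
        d₂ , d′ , eq′ = thm⇒equalInterpretations q
    in d , d′ , ≈.trans eq (≈.trans (coherent d₁ d₂) eq′)
  thm⇒equalInterpretations (sub p q) =
    let d₁ , d₁′ , eq₁ = thm⇒equalInterpretations p
        d₂ , d₂′ , eq₂ = thm⇒equalInterpretations q
    in sub d₁ d₂ , sub d₁′ d₂′ , ∘-resp-≈ eq₂ eq₁
  thm⇒equalInterpretations (tens p q u) =
    let d₁ , d₁′ , eq₁ = thm⇒equalInterpretations p
        d₂ , d₂′ , eq₂ = thm⇒equalInterpretations q
    in tens d₁ d₂ u , tens d₁′ d₂′ u , ∘-resp-≈ ≈.refl (∘-resp-≈ (⊗-resp-≈ eq₁ eq₂) ≈.refl)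
  -- In the structural cases the splitting of the context must be passed on explicitly, as _++ᵛ_ is not injective.
  thm⇒equalInterpretations (weak w {A₁} {A₂} {A₃} {x₁ = x₁} {x₂} {x₃} p u) =
    let d , d′ , eq = thm⇒equalInterpretations p
    in weak w {A₁} {A₂} {A₃} {x₁ = x₁} {x₂} {x₃} d u , weak w {A₁} {A₂} {A₃} {x₁ = x₁} {x₂} {x₃} d′ u ,
       ∘-resp-≈ eq ≈.refl
  thm⇒equalInterpretations (exch e σ p) =
    let d , d′ , eq = thm⇒equalInterpretations p in exch e σ d , exch e σ d′ , ∘-resp-≈ eq ≈.refl
  thm⇒equalInterpretations (contr c {A₁} {A} {A₂} {x₁ = x₁} {x} {x′} {x₂} p) =
    let d , d′ , eq = thm⇒equalInterpretations p
    in contr c {A₁} {A} {A₂} {x₁ = x₁} {x} {x′} {x₂} d , contr c {A₁} {A} {A₂} {x₁ = x₁} {x} {x′} {x₂} d′ ,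
       ∘-resp-≈ eq ≈.refl

  sound : (φ : Formula L) → IsTheorem 𝕋 φ → _⊨_ 𝐂 L (Model.structure M) φ
  sound φ p =
    let d , d′ , eq = thm⇒equalInterpretations p
    in ≈.trans (coherent (Formula.lhsTerm φ) d) (≈.trans eq (coherent d′ (Formula.rhsTerm φ)))

soundness : ∀ {L : Language} (𝕋 : Theory L) (φ : Formula L) → IsTheorem 𝕋 φ → Valid 𝕋 φ
soundness 𝕋 φ p 𝐂 M = Soundness.sound 𝕋 𝐂 M φ p

-- The monoidal category of terms

module Syntactic (L : Language) (𝕋 : Theory L) where
  open Language L
  open Substitution {Fun}
  open VarsProperties {Sort}
  open Derivations L

  canon : ℕ → (A : List Sort) → Vars A
  canon k [] = []
  canon k (a ∷ A) = k ∷ canon (suc k) A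

  varList-canon : ∀ k A → varList (canon k A) ≡ range k (length A)
  varList-canon k [] = refl
  varList-canon k (a ∷ A) = cong (k ∷_) (varList-canon (suc k) A)

  varTerm-canon : ∀ k A → varTerm {Fun} (canon k A) ≡ rangeTerm k (length A)
  varTerm-canon k A = ≡.trans (varTerm-map (canon k A)) (cong (map var) (varList-canon k A))

  canon-distinct : ∀ k A → Distinct L (canon k A)
  canon-distinct k A = subst Unique (≡.sym (varList-canon k A)) (Unique-range k (length A))

  canon-++ : ∀ k A C → canon k (A ++ C) ≡ canon k A ++ᵛ canon (k + length A) C
  canon-++ k [] C rewrite +-identityʳ k = refl
  canon-++ k (a ∷ A) C rewrite +-suc k (length A) = cong (k ∷_) (canon-++ (suc k) A C)

  Hom : List Sort → List Sort → Set
  Hom A B = Σ (Term L) (λ t → Der (canon 0 A) t B)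

  _≈_ : ∀ {A B} → Hom A B → Hom A B → Set
  _≈_ {A} {B} f g = Thm 𝕋 (canon 0 A) (proj₁ f) (proj₁ g) B

  castThmCtx : ∀ {A B} {x x' : Vars A} {s t} → x ≡ x' → Thm 𝕋 x s t B → Thm 𝕋 x' s t B
  castThmCtx refl p = p

  castThm : ∀ {A B} {x : Vars A} {s t s' t'} → s ≡ s' → t ≡ t' → Thm 𝕋 x s t B → Thm 𝕋 x s' t' B
  castThm refl refl p = p

  castThmTypes : ∀ {A A' B B' : List Sort} {s t} → A' ≡ A → B' ≡ B → Thm 𝕋 (canon 0 A') s t B' → Thm 𝕋 (canon 0 A) s t B
  castThmTypes refl refl p = p

  length-hom : ∀ {A B} (f : Hom A B) → length (proj₁ f) ≡ length B
  length-hom f = length-der (proj₂ f)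

  vars-hom : ∀ {A B} (f : Hom A B) → AllVars (_∈ range 0 (length A)) (proj₁ f)
  vars-hom {A} f = subst (λ l → AllVars (_∈ l) (proj₁ f)) (varList-canon 0 A) (vars-der (proj₂ f))

  ≡⇒≈ : ∀ {A B} {f g : Hom A B} → proj₁ f ≡ proj₁ g → f ≈ g
  ≡⇒≈ {A} {B} {f} p = subst (λ t → Thm 𝕋 (canon 0 A) (proj₁ f) t B) p (refl (proj₂ f))

  idʰ : ∀ {A} → Hom A A
  idʰ {A} = rangeTerm 0 (length A) , castTerm (varTerm-canon 0 A) (varTerm-der (canon 0 A) (canon-distinct 0 A))

  idʰ-cast : ∀ {A B} → A ≡ B → Hom A B
  idʰ-cast {A} p = rangeTerm 0 (length A) , subst (Der (canon 0 A) (rangeTerm 0 (length A))) p (proj₂ (idʰ {A}))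

  substTerm-canon : ∀ B (f g : Term L) → g [ f / varList (canon 0 B) ] ≡ substTermBy (plug (length B) f) g
  substTerm-canon B f g = ≡.trans (substTerm-substVar _ f g) (cong (λ l → substTermBy (substVar l f) g) (varList-canon 0 B))

  _∘ʰ_ : ∀ {A B C} → Hom B C → Hom A B → Hom A C
  _∘ʰ_ {A} {B} {C} g f =
    substTermBy (plug (length B) (proj₁ f)) (proj₁ g) ,
    castTerm (substTerm-canon B (proj₁ f) (proj₁ g)) (sub (proj₂ f) (proj₂ g))

  substTerm-canon-shift : ∀ a {C D'} (g : Hom C D') →
      proj₁ g [ varTerm (canon a C) / varList (canon 0 C) ] ≡ substTermBy (shift a) (proj₁ g)
  substTerm-canon-shift a {C} g =
    ≡.trans (substTerm-substVar _ _ (proj₁ g))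
      (≡.trans (cong₂ (λ l v → substTermBy (substVar l v) (proj₁ g)) (varList-canon 0 C) (varTerm-canon a C))
        (substTermBy-cong (proj₁ g) (AllVars-mono (substVar-range-rangeTerm a (length C)) (proj₁ g) (vars-hom g))))

  canon-++-distinct : ∀ A C → Distinct L (canon 0 A ++ᵛ canon (length A) C)
  canon-++-distinct A C = subst Unique (cong varList (canon-++ 0 A C)) (canon-distinct 0 (A ++ C))

  _⊗ʰ_ : ∀ {A B C D'} → Hom A B → Hom C D' → Hom (A ++ C) (B ++ D')
  _⊗ʰ_ {A} {B} {C} {D'} f g =
    proj₁ f ++ substTermBy (shift (length A)) (proj₁ g) ,
    castCtx (≡.sym (canon-++ 0 A C))
      (castTerm (cong (proj₁ f ++_) (substTerm-canon-shift (length A) g))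
        (tens (proj₂ f) (sub (varTerm-der (canon (length A) C) (canon-distinct _ C)) (proj₂ g)) (canon-++-distinct A C)))

  -- Associators, unitors and the interpretations of split and merge all have the identity term,
  -- so every equation between them holds by coherence-≈.
  IsCoherence : ∀ {A B} → Hom A B → Set
  IsCoherence {A} f = proj₁ f ≡ rangeTerm 0 (length A)

  assoc-terms : ∀ {A B C D'} (f : Hom A B) (g : Hom B C) (h : Hom C D') →
      proj₁ ((h ∘ʰ g) ∘ʰ f) ≡ proj₁ (h ∘ʰ (g ∘ʰ f))
  assoc-terms {A} {B} {C} f g h =
    ≡.trans (substTermBy-∘ (plug (length B) (proj₁ f)) (plug (length C) (proj₁ g)) (proj₁ h))
      (substTermBy-cong (proj₁ h) (AllVars-mono plug-plug (proj₁ h) (vars-hom h)))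
    where
    plug-plug : ∀ {z} → z ∈ range 0 (length C) →
        substAtomBy (plug (length B) (proj₁ f)) (plug (length C) (proj₁ g) z)
        ≡ plug (length C) (substTermBy (plug (length B) (proj₁ f)) (proj₁ g)) z
    plug-plug m = ≡.sym (substVar-substTermBy (plug (length B) (proj₁ f)) (range 0 (length C)) (proj₁ g) m
                          (≡.trans (length-range 0 _) (≡.sym (length-hom g))))

  coherence-∘ˡ : ∀ {A B C} (h : Hom B C) → IsCoherence h → (f : Hom A B) → proj₁ (h ∘ʰ f) ≡ proj₁ f
  coherence-∘ˡ {A} {B} h p f rewrite p =
    substTermBy-substVar-vars (range 0 (length B)) (proj₁ f) (Unique-range 0 _) (≡.trans (length-hom f) (≡.sym (length-range 0 _)))

  coherence-∘ʳ : ∀ {A B C} (f : Hom B C) (h : Hom A B) → IsCoherence h → proj₁ (f ∘ʰ h) ≡ proj₁ f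
  coherence-∘ʳ {A} {B} f h p =
    ≡.trans (cong (λ v → substTermBy (plug (length B) v) (proj₁ f)) (≡.trans p (cong (rangeTerm 0) ab)))
      (substTermBy-substVar-self (range 0 (length B)) (proj₁ f))
    where
    ab : length A ≡ length B
    ab = ≡.trans (≡.sym (length-rangeTerm 0 (length A))) (≡.trans (cong length (≡.sym p)) (length-hom h))

  IsCoherence-∘ : ∀ {A B C} (h : Hom B C) (f : Hom A B) → IsCoherence h → IsCoherence f → IsCoherence (h ∘ʰ f)
  IsCoherence-∘ h f p q = ≡.trans (coherence-∘ˡ h p f) q

  rangeTerm-⊗ : ∀ a c → rangeTerm 0 a ++ substTermBy (shift a) (rangeTerm 0 c) ≡ rangeTerm 0 (a + c)
  rangeTerm-⊗ a c = ≡.trans (cong (rangeTerm 0 a ++_) (shift-rangeTerm₀ a c)) (≡.sym (rangeTerm-++ 0 a c))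

  IsCoherence-⊗ : ∀ {A B C D'} (f : Hom A B) (g : Hom C D') → IsCoherence f → IsCoherence g → IsCoherence (f ⊗ʰ g)
  IsCoherence-⊗ {A} {B} {C} f g p q rewrite p | q =
    ≡.trans (rangeTerm-⊗ (length A) (length C)) (cong (rangeTerm 0) (≡.sym (length-++ A)))

  coherence-≈ : ∀ {A B} (f g : Hom A B) → IsCoherence f → IsCoherence g → f ≈ g
  coherence-≈ f g p q = ≡⇒≈ {f = f} {g} (≡.trans p (≡.sym q))

  ⊗-homomorphism-terms : ∀ (x y v : ℕ) (g f i h : Term L) → length g ≡ y → length i ≡ v →
      AllVars (_∈ range 0 y) f → AllVars (_∈ range 0 v) h →
      substTermBy (plug y g) f ++ substTermBy (shift x) (substTermBy (plug v i) h)
      ≡ substTermBy (plug (y + v) (g ++ substTermBy (shift x) i)) (f ++ substTermBy (shift y) h)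
  ⊗-homomorphism-terms x y v g f i h lg li fvf fvh =
    ≡.trans (cong₂ _++_ left right) (≡.sym (substTermBy-++ S f (substTermBy (shift y) h)))
    where
    S : Subst
    S = plug (y + v) (g ++ substTermBy (shift x) i)
    range-split : range 0 (y + v) ≡ range 0 y ++ range y v
    range-split = range-++ 0 y v
    left : substTermBy (plug y g) f ≡ substTermBy S f
    left = substTermBy-cong f (AllVars-mono (λ {z} m → ≡.sym (≡.trans (cong (λ l → substVar l (g ++ substTermBy (shift x) i) z) range-split)
             (substVar-++ˡ (range 0 y) (range y v) g (substTermBy (shift x) i) m (≡.trans (length-range 0 y) (≡.sym lg))))) f fvf)
    commutes : ∀ {z} → z ∈ range 0 v → substAtomBy (shift x) (plug v i z) ≡ S (y + z)
    commutes {z} m =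
      ≡.trans (≡.sym (substVar-substTermBy (shift x) (range 0 v) i m (≡.trans (length-range 0 v) (≡.sym li))))
        (≡.trans (substVar-range-shift y 0 v (substTermBy (shift x) i) m (≡.sym (≡.trans (length-substTermBy (shift x) i) li)))
          (≡.trans (cong (λ k → substVar (range k v) (substTermBy (shift x) i) (y + z)) (+-identityʳ y))
            (≡.sym (≡.trans (cong (λ l → substVar l (g ++ substTermBy (shift x) i) (y + z)) range-split)
               (substVar-++ʳ (range 0 y) (range y v) g (substTermBy (shift x) i) (+-∉-range y z) (≡.trans (length-range 0 y) (≡.sym lg)))))))
    right : substTermBy (shift x) (substTermBy (plug v i) h) ≡ substTermBy S (substTermBy (shift y) h)
    right = ≡.trans (substTermBy-∘ (shift x) (plug v i) h)
              (≡.trans (substTermBy-cong h (AllVars-mono commutes h fvh)) (≡.sym (substTermBy-∘ S (shift y) h)))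

  associator-natural-terms : ∀ {X X' Y Y' Z Z'} (f : Hom X X') (g : Hom Y Y') (h : Hom Z Z') →
      proj₁ ((f ⊗ʰ g) ⊗ʰ h) ≡ proj₁ (f ⊗ʰ (g ⊗ʰ h))
  associator-natural-terms {X} {X'} {Y} f g h =
    ≡.trans (++-assoc (proj₁ f) _ _)
      (cong (proj₁ f ++_) (≡.trans (cong (substTermBy (shift (length X)) (proj₁ g) ++_)
             (≡.trans (cong (λ k → substTermBy (shift k) (proj₁ h)) (length-++ X)) (≡.sym (shift-shift (length X) (length Y) (proj₁ h)))))
           (≡.sym (substTermBy-++ (shift (length X)) (proj₁ g) _))))

  associator : ∀ X Y Z → Hom ((X ++ Y) ++ Z) (X ++ (Y ++ Z))
  associator X Y Z = idʰ-cast (++-assoc X Y Z)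

  coherence-iso : ∀ {A B} (p : A ≡ B) (q : B ≡ A) → (idʰ-cast q ∘ʰ idʰ-cast p) ≈ idʰ {A}
  coherence-iso p q = coherence-≈ (idʰ-cast q ∘ʰ idʰ-cast p) idʰ (IsCoherence-∘ (idʰ-cast q) (idʰ-cast p) refl refl) refl

  TermCategory : MonoidalCategory lzero lzero lzero
  TermCategory = record
    { Obj = List Sort
    ; _⇒_ = Hom
    ; _≈_ = _≈_
    ; ≈-equiv = record { refl = λ {f} → refl (proj₂ f) ; sym = sym ; trans = trans }
    ; id = idʰ
    ; _∘_ = _∘ʰ_
    ; assoc = λ {A} {B} {C} {D'} {f} {g} {h} → ≡⇒≈ {f = (h ∘ʰ g) ∘ʰ f} {h ∘ʰ (g ∘ʰ f)} (assoc-terms f g h)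
    ; identityˡ = λ {A} {B} {f} → ≡⇒≈ {f = idʰ ∘ʰ f} {f} (coherence-∘ˡ idʰ refl f)
    ; identityʳ = λ {A} {B} {f} → ≡⇒≈ {f = f ∘ʰ idʰ} {f} (coherence-∘ʳ f idʰ refl)
    ; ∘-resp-≈ = λ {A} {B} {C} {f} {h} {g} {i} p q → castThm (substTerm-canon B _ _) (substTerm-canon B _ _) (sub q p)
    ; unit = []
    ; _⊗₀_ = _++_
    ; _⊗₁_ = _⊗ʰ_
    ; ⊗-identity = λ {A} {B} → coherence-≈ (idʰ {A} ⊗ʰ idʰ {B}) (idʰ {A ++ B}) (IsCoherence-⊗ (idʰ {A}) (idʰ {B}) refl refl) refl
    ; ⊗-homomorphism = λ {X} {Y} {Z} {U} {V} {W} {f} {g} {h} {i} →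
        ≡⇒≈ {f = (f ∘ʰ g) ⊗ʰ (h ∘ʰ i)} {(f ⊗ʰ h) ∘ʰ (g ⊗ʰ i)}
          (≡.trans (⊗-homomorphism-terms (length X) (length Y) (length V) (proj₁ g) (proj₁ f) (proj₁ i) (proj₁ h) (length-hom g) (length-hom i) (vars-hom f) (vars-hom h))
                  (cong (λ k → substTermBy (plug k (proj₁ g ++ substTermBy (shift (length X)) (proj₁ i))) (proj₁ f ++ substTermBy (shift (length Y)) (proj₁ h))) (≡.sym (length-++ Y))))
    ; ⊗-resp-≈ = λ {A} {B} {C} {D'} {f} {g} {h} {i} p q →
        castThmCtx (≡.sym (canon-++ 0 A C))
          (castThm (cong (proj₁ f ++_) (substTerm-canon-shift (length A) h)) (cong (proj₁ g ++_) (substTerm-canon-shift (length A) i))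
            (tens p (sub (refl (varTerm-der (canon (length A) C) (canon-distinct _ C))) q) (canon-++-distinct A C)))
    ; associator⇒ = λ {X} {Y} {Z} → associator X Y Z
    ; associator⇐ = λ {X} {Y} {Z} → idʰ-cast (≡.sym (++-assoc X Y Z))
    ; associator-isoˡ = λ {X} {Y} {Z} → coherence-iso (++-assoc X Y Z) (≡.sym (++-assoc X Y Z))
    ; associator-isoʳ = λ {X} {Y} {Z} → coherence-iso (≡.sym (++-assoc X Y Z)) (++-assoc X Y Z)
    ; associator-natural = λ {X} {Y} {Z} {X'} {Y'} {Z'} {f} {g} {h} →
        ≡⇒≈ {f = idʰ-cast (++-assoc X' Y' Z') ∘ʰ ((f ⊗ʰ g) ⊗ʰ h)} {(f ⊗ʰ (g ⊗ʰ h)) ∘ʰ idʰ-cast (++-assoc X Y Z)}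
          (≡.trans (coherence-∘ˡ (idʰ-cast (++-assoc X' Y' Z')) refl ((f ⊗ʰ g) ⊗ʰ h))
            (≡.trans (associator-natural-terms f g h) (≡.sym (coherence-∘ʳ (f ⊗ʰ (g ⊗ʰ h)) (idʰ-cast (++-assoc X Y Z)) refl))))
    ; unitorˡ⇒ = idʰ-cast refl
    ; unitorˡ⇐ = idʰ-cast refl
    ; unitorˡ-isoˡ = coherence-iso refl refl
    ; unitorˡ-isoʳ = coherence-iso refl refl
    ; unitorˡ-natural = λ {X} {Y} {f} →
        ≡⇒≈ {f = idʰ-cast refl ∘ʰ (idʰ {[]} ⊗ʰ f)} {f ∘ʰ idʰ-cast refl}
          (≡.trans (coherence-∘ˡ (idʰ-cast refl) refl (idʰ {[]} ⊗ʰ f)) (≡.trans (substTermBy-var (proj₁ f)) (≡.sym (coherence-∘ʳ f (idʰ-cast refl) refl))))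
    ; unitorʳ⇒ = λ {X} → idʰ-cast (++-identityʳ X)
    ; unitorʳ⇐ = λ {X} → idʰ-cast (≡.sym (++-identityʳ X))
    ; unitorʳ-isoˡ = λ {X} → coherence-iso (++-identityʳ X) (≡.sym (++-identityʳ X))
    ; unitorʳ-isoʳ = λ {X} → coherence-iso (≡.sym (++-identityʳ X)) (++-identityʳ X)
    ; unitorʳ-natural = λ {X} {Y} {f} →
        ≡⇒≈ {f = idʰ-cast (++-identityʳ Y) ∘ʰ (f ⊗ʰ idʰ {[]})} {f ∘ʰ idʰ-cast (++-identityʳ X)}
          (≡.trans (coherence-∘ˡ (idʰ-cast (++-identityʳ Y)) refl (f ⊗ʰ idʰ {[]})) (≡.trans (++-identityʳ (proj₁ f)) (≡.sym (coherence-∘ʳ f (idʰ-cast (++-identityʳ X)) refl))))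
    ; triangle = λ {X} {Y} →
        coherence-≈ ((idʰ {X} ⊗ʰ idʰ-cast {Y} refl) ∘ʰ associator X [] Y) (idʰ-cast (++-identityʳ X) ⊗ʰ idʰ {Y})
          (IsCoherence-∘ (idʰ {X} ⊗ʰ idʰ-cast {Y} refl) (associator X [] Y) (IsCoherence-⊗ (idʰ {X}) (idʰ-cast {Y} refl) refl refl) refl)
          (IsCoherence-⊗ (idʰ-cast (++-identityʳ X)) (idʰ {Y}) refl refl)
    ; pentagon = λ {W} {X} {Y} {Z} →
        coherence-≈ ((idʰ {W} ⊗ʰ associator X Y Z) ∘ʰ (associator W (X ++ Y) Z ∘ʰ (associator W X Y ⊗ʰ idʰ {Z}))) (associator W X (Y ++ Z) ∘ʰ associator (W ++ X) Y Z)
          (IsCoherence-∘ (idʰ {W} ⊗ʰ associator X Y Z) (associator W (X ++ Y) Z ∘ʰ (associator W X Y ⊗ʰ idʰ {Z})) (IsCoherence-⊗ (idʰ {W}) (associator X Y Z) refl refl)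
             (IsCoherence-∘ (associator W (X ++ Y) Z) (associator W X Y ⊗ʰ idʰ {Z}) refl (IsCoherence-⊗ (associator W X Y) (idʰ {Z}) refl refl)))
          (IsCoherence-∘ (associator W X (Y ++ Z)) (associator (W ++ X) Y Z) refl refl)
    }

-- The generic model

module Generic (L : Language) (𝕋 : Theory L) where
  open Language L
  open Substitution {Fun}
  open VarsProperties {Sort}
  open Derivations L
  open Syntactic L 𝕋
  open ≡.≡-Reasoning

  atomic : Sort → List Sort
  atomic a = a ∷ []

  interp : List Sort → List Sort
  interp A = ⟦_⟧ₜ[_] TermCategory A atomic

  -- This holds only propositionally, which is why the structure maps below are cast along it.
  interp≡ : ∀ A → interp A ≡ A
  interp≡ [] = refl
  interp≡ (a ∷ A) = cong (a ∷_) (interp≡ A)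

  length-interp : ∀ A → length (interp A) ≡ length A
  length-interp A = cong length (interp≡ A)

  castHom : ∀ {A A' B B'} → A ≡ A' → B ≡ B' → Hom A B → Hom A' B'
  castHom p q h = proj₁ h , subst₂ (λ A B → Der (canon 0 A) (proj₁ h) B) p q (proj₂ h)

  canon-args : ∀ k B → Args L (canon k B) (singletons (varTerm (canon k B))) B
  canon-args k [] = []
  canon-args k (b ∷ B) = var k b ∷ canon-args (suc k) B

  funʰ : (f : Fun) → Hom (dom f) (cod f ∷ [])
  funʰ f = app f (singletons (varTerm (canon 0 (dom f)))) ∷ [] , fun f (canon-args 0 (dom f)) (canon-distinct 0 (dom f))

  -- Each structural arrow is its rule applied to an identity: π forgets the variables, Δ duplicates
  -- them and σ permutes them.
  πʰ : T weakening → ∀ A → Hom A []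
  πʰ w A = castHom (++-identityʳ A) refl ([] , castCtx (≡.sym (canon-++ 0 A [])) (weak w {[]} {A} {[]} {[]} {[]} {canon 0 A} {[]} {[]} empty u))
    where
    u : Distinct L ([] ++ᵛ canon 0 A ++ᵛ [])
    u = subst Unique (cong varList (canon-++ 0 A [])) (canon-distinct 0 (A ++ []))

  Δ-term : ∀ A → (varTerm (canon 0 A) ++ (varTerm (canon (length A) A) ++ [])) [ varTerm (canon 0 A) / varList (canon (length A) A) ]
      ≡ rangeTerm 0 (length A) ++ rangeTerm 0 (length A)
  Δ-term A rewrite substTerm-substVar (varList (canon (length A) A)) (varTerm (canon 0 A)) (varTerm (canon 0 A) ++ (varTerm (canon (length A) A) ++ []))
               | varTerm-canon 0 A | varTerm-canon (length A) A | varList-canon (length A) A | ++-identityʳ (rangeTerm (length A) (length A)) =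
    ≡.trans (substTermBy-++ _ (rangeTerm 0 a) (rangeTerm a a))
      (cong₂ _++_ (≡.trans (substTermBy-cong (rangeTerm 0 a) (AllVars-map-var (range 0 a) (λ {z} m → substVar-∉ (range a a) (rangeTerm 0 a) (λ m' → <⇒≱ (proj₂ (∈-range⁻ 0 a m)) (proj₁ (∈-range⁻ a a m')))))) (substTermBy-var _))
                  (substTermBy-substVar-vars (range a a) (rangeTerm 0 a) (Unique-range a a) (≡.trans (length-rangeTerm 0 a) (≡.sym (length-range a a)))))
    where
    a : ℕ
    a = length A

  Δʰ : T contraction → ∀ A → Hom A (A ++ A)
  Δʰ c A = castHom (++-identityʳ A) (cong (A ++_) (++-identityʳ A))
     (rangeTerm 0 a ++ rangeTerm 0 a , castCtx (≡.sym (canon-++ 0 A [])) (castTerm (Δ-term A) (contr c {[]} {A} {[]} {A ++ (A ++ [])} {[]} {canon 0 A} {canon a A} {[]} d0)))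
    where
    a : ℕ
    a = length A
    u2 : Distinct L (canon 0 A ++ᵛ (canon a A ++ᵛ []))
    u2 = subst Unique (cong varList (≡.trans (canon-++ 0 A (A ++ [])) (cong (canon 0 A ++ᵛ_) (canon-++ a A [])))) (canon-distinct 0 (A ++ (A ++ [])))
    u1 : Distinct L (canon a A ++ᵛ [])
    u1 = subst Unique (cong varList (canon-++ a A [])) (canon-distinct a (A ++ []))
    d0 : Der (canon 0 A ++ᵛ (canon a A ++ᵛ [])) (varTerm (canon 0 A) ++ (varTerm (canon a A) ++ [])) (A ++ (A ++ []))
    d0 = tens (varTerm-der (canon 0 A) (canon-distinct 0 A)) (tens (varTerm-der (canon a A) (canon-distinct a A)) empty u1) u2

  tabulateᵛ-canon : ∀ {n} (f : Fin n → Sort) (h : Fin n → ℕ) k → (∀ i → h i ≡ k + toℕ i) → tabulateᵛ f h ≡ canon k (tabulate f)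
  tabulateᵛ-canon {zero} f h k p = refl
  tabulateᵛ-canon {suc n} f h k p =
    cong₂ (_∷_ {a = f zero}) (≡.trans (p zero) (+-identityʳ k))
      (tabulateᵛ-canon (λ i → f (suc i)) (λ i → h (suc i)) (suc k) (λ i → ≡.trans (p (suc i)) (+-suc k (toℕ i))))

  inverseVars : ∀ A → Permutation′ (length A) → Vars A
  inverseVars A τ = tabulateVars A (λ j → toℕ (τ ⟨$⟩ˡ j))

  inverseVars-distinct : ∀ A τ → Distinct L (inverseVars A τ)
  inverseVars-distinct A τ = subst Unique (≡.sym (varList-tabulateVars A _))
    (tabulate⁺ (λ {i} {j} p → ≡.trans (≡.sym (inverseʳ τ)) (≡.trans (cong (τ ⟨$⟩ʳ_) (toℕ-injective p)) (inverseʳ τ))))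

  σʰ : T exchange → ∀ A (τ : Permutation′ (length A)) → Hom (permute A τ) A
  σʰ e A τ = varTerm (inverseVars A τ) , castCtx permuted-canon (exch e τ (varTerm-der (inverseVars A τ) (inverseVars-distinct A τ)))
    where
    permuted-canon : permuteᵛ (inverseVars A τ) τ ≡ canon 0 (permute A τ)
    permuted-canon = tabulateᵛ-canon (λ i → lookup A (τ ⟨$⟩ʳ i)) _ 0 (λ i → ≡.trans (lookupᵛ-tabulateVars A _ (τ ⟨$⟩ʳ i)) (cong toℕ (inverseˡ τ)))

  generic : Prestructure TermCategory L
  generic = record
    { sort = atomic
    ; func = λ f → castHom (≡.sym (interp≡ (dom f))) refl (funʰ f)
    ; π = λ w A → castHom (≡.sym (interp≡ A)) refl (πʰ w A)
    ; σ = λ e A τ → castHom (≡.sym (interp≡ (permute A τ))) (≡.sym (interp≡ A)) (σʰ e A τ)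
    ; Δ = λ c A → castHom (≡.sym (interp≡ A)) (≡.sym (interp≡ (A ++ A))) (Δʰ c A)
    }

  module I = Interp TermCategory L generic

  -- position x z is the variable i when z is the i-th variable of x (counting from 0).
  position : ∀ {A : List Sort} → Vars A → Subst
  position {A} x = substVar (varList x) (rangeTerm 0 (length A))

  length-varList-rangeTerm : ∀ {A : List Sort} (x : Vars A) k → length (varList x) ≡ length (rangeTerm k (length A))
  length-varList-rangeTerm x k = ≡.trans (length-varList x) (≡.sym (length-rangeTerm k _))

  split-coherence : ∀ A C → IsCoherence (I.spl A C)
  split-coherence [] C = refl
  split-coherence (a ∷ A) C = IsCoherence-∘ {(a ∷ []) ++ interp (A ++ C)} {(a ∷ []) ++ (interp A ++ interp C)} {((a ∷ []) ++ interp A) ++ interp C}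
    (idʰ-cast (≡.sym (++-assoc (a ∷ []) (interp A) (interp C)))) (idʰ ⊗ʰ I.spl A C) refl
    (IsCoherence-⊗ {a ∷ []} {a ∷ []} {interp (A ++ C)} {interp A ++ interp C} (idʰ {a ∷ []}) (I.spl A C) refl (split-coherence A C))

  merge-coherence : ∀ A C → IsCoherence (I.mrg A C)
  merge-coherence [] C = refl
  merge-coherence (a ∷ A) C = IsCoherence-∘ {((a ∷ []) ++ interp A) ++ interp C} {(a ∷ []) ++ (interp A ++ interp C)} {(a ∷ []) ++ interp (A ++ C)}
    (idʰ ⊗ʰ I.mrg A C) (idʰ-cast (++-assoc (a ∷ []) (interp A) (interp C)))
    (IsCoherence-⊗ {a ∷ []} {a ∷ []} {interp A ++ interp C} {interp (A ++ C)} (idʰ {a ∷ []}) (I.mrg A C) refl (merge-coherence A C)) refl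

  position-++₂ : ∀ {A C : List Sort} (x : Vars A) (y : Vars C) z →
      position (x ++ᵛ y) z ≡ substVar (varList x ++ varList y) (rangeTerm 0 (length A) ++ rangeTerm (length A) (length C)) z
  position-++₂ {A} {C} x y z rewrite varList-++ x y | length-++ A {C} | rangeTerm-++ 0 (length A) (length C) = refl

  position-++₃ : ∀ {A B C : List Sort} (x : Vars A) (y : Vars B) (w : Vars C) z →
      position (x ++ᵛ y ++ᵛ w) z ≡ substVar (varList x ++ varList y ++ varList w)
        (rangeTerm 0 (length A) ++ rangeTerm (length A) (length B) ++ rangeTerm (length A + length B) (length C)) z
  position-++₃ {A} {B} {C} x y w z rewrite varList-++ x (y ++ᵛ w) | varList-++ y w | length-++ A {B ++ C} | length-++ B {C}
    | rangeTerm-++ 0 (length A) (length B + length C) | rangeTerm-++ (length A) (length B) (length C) = refl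

  position-++₄ : ∀ {A B C E : List Sort} (x : Vars A) (y : Vars B) (w : Vars C) (v : Vars E) z →
      position (x ++ᵛ y ++ᵛ w ++ᵛ v) z ≡ substVar (varList x ++ varList y ++ varList w ++ varList v)
        (rangeTerm 0 (length A) ++ rangeTerm (length A) (length B) ++ rangeTerm (length A + length B) (length C)
          ++ rangeTerm (length A + length B + length C) (length E)) z
  position-++₄ {A} {B} {C} {E} x y w v z rewrite varList-++ x (y ++ᵛ w ++ᵛ v) | varList-++ y (w ++ᵛ v) | varList-++ w v
    | length-++ A {B ++ C ++ E} | length-++ B {C ++ E} | length-++ C {E}
    | rangeTerm-++ 0 (length A) (length B + (length C + length E)) | rangeTerm-++ (length A) (length B) (length C + length E)
    | rangeTerm-++ (length A + length B) (length C) (length E) = refl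

  position-++ˡ : ∀ {A C : List Sort} (x : Vars A) (y : Vars C) {z} → z ∈ varList x → position (x ++ᵛ y) z ≡ position x z
  position-++ˡ x y {z} m = ≡.trans (position-++₂ x y z) (substVar-++ˡ (varList x) (varList y) _ _ m (length-varList-rangeTerm x 0))

  position-++ʳ : ∀ {A C : List Sort} (x : Vars A) (y : Vars C) → Unique (varList x ++ varList y) → ∀ {z} → z ∈ varList y →
      substAtomBy (shift (length A)) (position y z) ≡ position (x ++ᵛ y) z
  position-++ʳ {A} {C} x y uq {z} m =
    ≡.trans (≡.sym (substVar-substTermBy (shift (length A)) (varList y) (rangeTerm 0 (length C)) m (length-varList-rangeTerm y 0)))
      (≡.trans (cong (λ u → substVar (varList y) u z) (shift-rangeTerm₀ (length A) (length C)))
        (≡.sym (≡.trans (position-++₂ x y z) (substVar-++ʳ (varList x) (varList y) _ _ (λ m' → Unique-++⇒disjoint (varList x) uq m' m) (length-varList-rangeTerm x 0)))))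

  position-tens : ∀ {A C : List Sort} (x : Vars A) (y : Vars C) s t → Unique (varList (x ++ᵛ y)) →
      AllVars (_∈ varList x) s → AllVars (_∈ varList y) t →
      substTermBy (position x) s ++ substTermBy (shift (length A)) (substTermBy (position y) t) ≡ substTermBy (position (x ++ᵛ y)) (s ++ t)
  position-tens {A} x y s t uq fs ft =
    ≡.trans (cong₂ _++_ (substTermBy-cong s (AllVars-mono (λ m → ≡.sym (position-++ˡ x y m)) s fs))
                       (≡.trans (substTermBy-∘ (shift (length A)) (position y) t) (substTermBy-cong t (AllVars-mono (λ m → position-++ʳ x y uq' m) t ft))))
           (≡.sym (substTermBy-++ (position (x ++ᵛ y)) s t))
    where
    uq' : Unique (varList x ++ varList y)
    uq' = subst Unique (varList-++ x y) uq

  weakeningTerm : ℕ → ℕ → ℕ → Term L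
  weakeningTerm a₁ a₂ a₃ = rangeTerm 0 a₁ ++ rangeTerm (a₁ + a₂) a₃

  weakeningTerm-cong : ∀ {n₁ n₂ n₃ m₁ m₂ m₃} → n₁ ≡ m₁ → n₂ ≡ m₂ → n₃ ≡ m₃ → weakeningTerm n₁ n₂ n₃ ≡ weakeningTerm m₁ m₂ m₃
  weakeningTerm-cong refl refl refl = refl

  weakening-term : ∀ (w : T weakening) A₁ A₂ A₃ →
      proj₁ (I.mrg A₁ A₃ ∘ʰ ((idʰ {interp A₁} ⊗ʰ (idʰ-cast {interp A₃} refl ∘ʰ ((Prestructure.π generic w A₂ ⊗ʰ idʰ {interp A₃}) ∘ʰ I.spl A₂ A₃))) ∘ʰ I.spl A₁ (A₂ ++ A₃)))
      ≡ weakeningTerm (length A₁) (length A₂) (length A₃)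
  weakening-term w A₁ A₂ A₃ =
    ≡.trans (coherence-∘ˡ (I.mrg A₁ A₃) (merge-coherence A₁ A₃) ((idʰ {interp A₁} ⊗ʰ W) ∘ʰ I.spl A₁ (A₂ ++ A₃)))
    (≡.trans (coherence-∘ʳ (idʰ {interp A₁} ⊗ʰ W) (I.spl A₁ (A₂ ++ A₃)) (split-coherence A₁ (A₂ ++ A₃)))
    (≡.trans (cong (λ v → rangeTerm 0 (length (interp A₁)) ++ substTermBy (shift (length (interp A₁))) v) Wt)
    (≡.trans (cong (rangeTerm 0 (length (interp A₁)) ++_) (shift-rangeTerm (length (interp A₁)) (length (interp A₂)) (length (interp A₃))))
      (weakeningTerm-cong (length-interp A₁) (length-interp A₂) (length-interp A₃)))))
    where
    W : Hom (interp (A₂ ++ A₃)) (interp A₃)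
    W = idʰ-cast {interp A₃} refl ∘ʰ ((Prestructure.π generic w A₂ ⊗ʰ idʰ {interp A₃}) ∘ʰ I.spl A₂ A₃)
    Wt : proj₁ W ≡ rangeTerm (length (interp A₂)) (length (interp A₃))
    Wt = ≡.trans (coherence-∘ˡ (idʰ-cast {interp A₃} refl) refl ((Prestructure.π generic w A₂ ⊗ʰ idʰ {interp A₃}) ∘ʰ I.spl A₂ A₃))
           (≡.trans (coherence-∘ʳ (Prestructure.π generic w A₂ ⊗ʰ idʰ {interp A₃}) (I.spl A₂ A₃) (split-coherence A₂ A₃)) (shift-rangeTerm₀ _ _))

  module Weakening {A₁ A₂ A₃ : List Sort} (x₁ : Vars A₁) (x₂ : Vars A₂) (x₃ : Vars A₃)
                   (distinct : Unique (varList (x₁ ++ᵛ x₂ ++ᵛ x₃))) (distinct₁₃ : Unique (varList (x₁ ++ᵛ x₃))) where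
    a₁ a₂ a₃ : ℕ
    a₁ = length A₁
    a₂ = length A₂
    a₃ = length A₃

    v₁ v₂ v₃ : List ℕ
    v₁ = varList x₁
    v₂ = varList x₂
    v₃ = varList x₃

    S : Subst
    S = plug (a₁ + a₃) (weakeningTerm a₁ a₂ a₃)

    Commutes : ℕ → Set
    Commutes z = substAtomBy S (position (x₁ ++ᵛ x₃) z) ≡ position (x₁ ++ᵛ x₂ ++ᵛ x₃) z

    commutes-x₁ : ∀ {z} → z ∈ v₁ → Commutes z
    commutes-x₁ {z} m =
      ≡.trans (cong (substAtomBy S) (position-++ˡ x₁ x₃ m))
        (≡.trans (≡.sym (substVar-substTermBy S v₁ (rangeTerm 0 a₁) m (length-varList-rangeTerm x₁ 0)))
          (≡.trans (cong (λ q → substVar v₁ q z) plug-block₁)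
            (≡.sym (≡.trans (position-++₃ x₁ x₂ x₃ z) (substVar-++ˡ v₁ _ (rangeTerm 0 a₁) _ m (length-varList-rangeTerm x₁ 0))))))
      where
      plug-block₁ : substTermBy S (rangeTerm 0 a₁) ≡ rangeTerm 0 a₁
      plug-block₁ = plug-slice 0 a₁ (a₁ + a₃) [] (rangeTerm 0 a₁) (rangeTerm (a₁ + a₂) a₃) refl (length-rangeTerm 0 a₁)
                      (cong (a₁ +_) (≡.sym (length-rangeTerm _ a₃)))

    commutes-x₃ : ∀ {z} → z ∉ v₁ → z ∉ v₂ → z ∈ v₃ → Commutes z
    commutes-x₃ {z} n₁ n₂ m =
      ≡.trans (cong (substAtomBy S) (≡.trans (position-++₂ x₁ x₃ z) (substVar-++ʳ v₁ v₃ _ _ n₁ (length-varList-rangeTerm x₁ 0))))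
        (≡.trans (≡.sym (substVar-substTermBy S v₃ (rangeTerm a₁ a₃) m (length-varList-rangeTerm x₃ a₁)))
          (≡.trans (cong (λ q → substVar v₃ q z) plug-block₃)
            (≡.sym (≡.trans (position-++₃ x₁ x₂ x₃ z)
                      (≡.trans (substVar-++ʳ v₁ (v₂ ++ v₃) (rangeTerm 0 a₁) _ n₁ (length-varList-rangeTerm x₁ 0))
                        (substVar-++ʳ v₂ v₃ (rangeTerm a₁ a₂) _ n₂ (length-varList-rangeTerm x₂ a₁)))))))
      where
      plug-block₃ : substTermBy S (rangeTerm a₁ a₃) ≡ rangeTerm (a₁ + a₂) a₃
      plug-block₃ =
        ≡.trans (cong (λ g → substTermBy (plug (a₁ + a₃) (rangeTerm 0 a₁ ++ g)) (rangeTerm a₁ a₃)) (≡.sym (++-identityʳ (rangeTerm (a₁ + a₂) a₃))))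
          (plug-slice a₁ a₃ (a₁ + a₃) (rangeTerm 0 a₁) (rangeTerm (a₁ + a₂) a₃) [] (length-rangeTerm 0 a₁) (length-rangeTerm _ a₃)
            (cong (a₁ +_) (≡.sym (+-identityʳ a₃))))

    commutes : ∀ {z} → z ∈ varList (x₁ ++ᵛ x₃) → Commutes z
    commutes m with ∈-++ᵛ⁻ x₁ x₃ m
    ... | inj₁ m₁ = commutes-x₁ m₁
    ... | inj₂ m₃ = commutes-x₃ (λ m₁ → Unique-++⇒disjoint v₁ distinct₁₃′ m₁ m₃) (λ m₂ → Unique-++⇒disjoint v₂ distinct₂₃ m₂ m₃) m₃
      where
      distinct₁₃′ : Unique (v₁ ++ v₃)
      distinct₁₃′ = subst Unique (varList-++ x₁ x₃) distinct₁₃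
      distinct₂₃ : Unique (v₂ ++ v₃)
      distinct₂₃ = Unique-++⁻ʳ v₁ (subst Unique (varList-++₃ x₁ x₂ x₃) distinct)

  position-weak : ∀ {A₁ A₂ A₃ : List Sort} (x₁ : Vars A₁) (x₂ : Vars A₂) (x₃ : Vars A₃) t →
      Unique (varList (x₁ ++ᵛ x₂ ++ᵛ x₃)) → Unique (varList (x₁ ++ᵛ x₃)) → AllVars (_∈ varList (x₁ ++ᵛ x₃)) t →
      substTermBy (plug (length A₁ + length A₃) (weakeningTerm (length A₁) (length A₂) (length A₃))) (substTermBy (position (x₁ ++ᵛ x₃)) t)
      ≡ substTermBy (position (x₁ ++ᵛ x₂ ++ᵛ x₃)) t
  position-weak x₁ x₂ x₃ t u u₁₃ fv = ≡.trans (substTermBy-∘ _ _ t) (substTermBy-cong t (AllVars-mono commutes t fv))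
    where
    open Weakening x₁ x₂ x₃ u u₁₃

  position-exch : ∀ {A : List Sort} (y : Vars A) t (τ : Permutation′ (length A)) →
      Unique (varList y) → Unique (varList (permuteᵛ y τ)) → AllVars (_∈ varList y) t →
      substTermBy (plug (length A) (varTerm (inverseVars A τ))) (substTermBy (position y) t) ≡ substTermBy (position (permuteᵛ y τ)) t
  position-exch {A} y t τ uq uqπ fv = ≡.trans (substTermBy-∘ _ _ t) (substTermBy-cong t (AllVars-mono commutes t fv))
    where
    a : ℕ
    a = length A
    S : Subst
    S = plug a (varTerm (inverseVars A τ))
    f : Fin (length A) → Sort
    f i = lookup A (τ ⟨$⟩ʳ i)
    h : Fin (length A) → ℕ
    h i = lookupᵛ y (τ ⟨$⟩ʳ i)
    lenvtx : length (varTerm {Fun} (inverseVars A τ)) ≡ a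
    lenvtx = length-varTerm (inverseVars A τ)
    -- Both sides send the j-th variable of y to the variable τ⁻¹ j.
    commutes : ∀ {z} → z ∈ varList y → substAtomBy S (position y z) ≡ position (permuteᵛ y τ) z
    commutes {z} m with ∈⇒lookupᵛ y m
    ... | j , refl = ≡.trans lhs (≡.sym rhs)
      where
      lhs : substAtomBy S (position y (lookupᵛ y j)) ≡ var (toℕ (τ ⟨$⟩ˡ j))
      lhs = ≡.trans (cong (substAtomBy S) (≡.trans (substVar-lookupᵛ y (rangeTerm 0 a) uq (length-rangeTerm 0 a) j) (lookupAtom-rangeTerm 0 a (toℕ j) (toℕ<n j))))
              (≡.trans (substVar-range-lookup 0 a (toℕ j) (varTerm (inverseVars A τ)) (toℕ<n j) lenvtx)
                (≡.trans (lookupAtom-varTerm (inverseVars A τ) j) (cong var (lookupᵛ-tabulateVars A _ j))))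
      rhs : position (permuteᵛ y τ) (lookupᵛ y j) ≡ var (toℕ (τ ⟨$⟩ˡ j))
      rhs = ≡.trans (cong₂ (λ l w → substVar l (rangeTerm 0 (length (permute A τ))) w) (varList-tabulateᵛ f h) (cong (lookupᵛ y) (≡.sym (inverseʳ τ))))
              (≡.trans (substVar-tabulate h (rangeTerm 0 (length (permute A τ))) (subst Unique (varList-tabulateᵛ f h) uqπ)
                         (≡.trans (length-rangeTerm 0 _) (length-tabulate f)) (τ ⟨$⟩ˡ j))
                 (lookupAtom-rangeTerm 0 _ _ (subst (toℕ (τ ⟨$⟩ˡ j) <_) (≡.sym (length-tabulate f)) (toℕ<n _))))

  contractionTerm : ℕ → ℕ → ℕ → Term L
  contractionTerm a₁ a a₂ = rangeTerm 0 a₁ ++ (rangeTerm a₁ a ++ (rangeTerm a₁ a ++ rangeTerm (a₁ + a) a₂))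

  contractionTerm-tensor : ∀ {n₁ n n₂ m₁ m m₂} → n₁ ≡ m₁ → n ≡ m → n₂ ≡ m₂ →
      rangeTerm 0 n₁ ++ substTermBy (shift n₁) ((rangeTerm 0 n ++ rangeTerm 0 n) ++ rangeTerm n n₂)
      ≡ contractionTerm m₁ m m₂
  contractionTerm-tensor {n₁} {n} {n₂} refl refl refl =
    cong (rangeTerm 0 n₁ ++_)
      (≡.trans (substTermBy-++ (shift n₁) (rangeTerm 0 n ++ rangeTerm 0 n) _)
        (≡.trans (cong₂ _++_ (substTermBy-++ (shift n₁) (rangeTerm 0 n) _) (shift-rangeTerm n₁ n n₂))
          (≡.trans (cong (λ v → (v ++ v) ++ rangeTerm (n₁ + n) n₂) (shift-rangeTerm₀ n₁ n))
            (++-assoc (rangeTerm n₁ n) _ _))))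

  contraction-term : ∀ (c : T contraction) A₁ A A₂ →
      proj₁ (I.mrg A₁ (A ++ A ++ A₂) ∘ʰ ((idʰ {interp A₁} ⊗ʰ
        (I.mrg A (A ++ A₂) ∘ʰ ((idʰ {interp A} ⊗ʰ I.mrg A A₂) ∘ʰ (idʰ-cast (++-assoc (interp A) (interp A) (interp A₂)) ∘ʰ
          (((I.spl A A ∘ʰ Prestructure.Δ generic c A) ⊗ʰ idʰ {interp A₂}) ∘ʰ I.spl A A₂)))))
        ∘ʰ I.spl A₁ (A ++ A₂)))
      ≡ contractionTerm (length A₁) (length A) (length A₂)
  contraction-term c A₁ A A₂ =
    ≡.trans (coherence-∘ˡ (I.mrg A₁ (A ++ A ++ A₂)) (merge-coherence A₁ (A ++ A ++ A₂)) ((idʰ {interp A₁} ⊗ʰ Q) ∘ʰ I.spl A₁ (A ++ A₂)))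
    (≡.trans (coherence-∘ʳ (idʰ {interp A₁} ⊗ʰ Q) (I.spl A₁ (A ++ A₂)) (split-coherence A₁ (A ++ A₂)))
    (≡.trans (cong (λ v → rangeTerm 0 (length (interp A₁)) ++ substTermBy (shift (length (interp A₁))) v) Qt)
      (contractionTerm-tensor (length-interp A₁) (length-interp A) (length-interp A₂))))
    where
    X4 : Hom (interp (A ++ A₂)) ((interp A ++ interp A) ++ interp A₂)
    X4 = ((I.spl A A ∘ʰ Prestructure.Δ generic c A) ⊗ʰ idʰ {interp A₂}) ∘ʰ I.spl A A₂
    X3 : Hom (interp (A ++ A₂)) (interp A ++ (interp A ++ interp A₂))
    X3 = idʰ-cast (++-assoc (interp A) (interp A) (interp A₂)) ∘ʰ X4
    X2 : Hom (interp (A ++ A₂)) (interp A ++ interp (A ++ A₂))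
    X2 = (idʰ {interp A} ⊗ʰ I.mrg A A₂) ∘ʰ X3
    Q : Hom (interp (A ++ A₂)) (interp (A ++ A ++ A₂))
    Q = I.mrg A (A ++ A₂) ∘ʰ X2
    Qt : proj₁ Q ≡ (rangeTerm 0 (length (interp A)) ++ rangeTerm 0 (length (interp A))) ++ rangeTerm (length (interp A)) (length (interp A₂))
    Qt = ≡.trans (coherence-∘ˡ (I.mrg A (A ++ A₂)) (merge-coherence A (A ++ A₂)) X2)
         (≡.trans (coherence-∘ˡ (idʰ {interp A} ⊗ʰ I.mrg A A₂) (IsCoherence-⊗ {interp A} {interp A} {interp A ++ interp A₂} {interp (A ++ A₂)} (idʰ {interp A}) (I.mrg A A₂) refl (merge-coherence A A₂)) X3)
         (≡.trans (coherence-∘ˡ (idʰ-cast (++-assoc (interp A) (interp A) (interp A₂))) refl X4)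
         (≡.trans (coherence-∘ʳ ((I.spl A A ∘ʰ Prestructure.Δ generic c A) ⊗ʰ idʰ {interp A₂}) (I.spl A A₂) (split-coherence A A₂))
           (cong₂ _++_ (≡.trans (coherence-∘ˡ (I.spl A A) (split-coherence A A) (Prestructure.Δ generic c A)) (cong (λ n → rangeTerm 0 n ++ rangeTerm 0 n) (≡.sym (length-interp A))))
                       (shift-rangeTerm₀ (length (interp A)) (length (interp A₂)))))))

  length-++₄ : ∀ (A₁ A A₂ : List Sort) → length (A₁ ++ A ++ A ++ A₂) ≡ length A₁ + (length A + (length A + length A₂))
  length-++₄ A₁ A A₂ = ≡.trans (length-++ A₁) (cong (length A₁ +_) (≡.trans (length-++ A) (cong (length A +_) (length-++ A))))

  module Contraction {A₁ A A₂ : List Sort} (x₁ : Vars A₁) (x x′ : Vars A) (x₂ : Vars A₂)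
                     (distinct : Unique (varList (x₁ ++ᵛ x ++ᵛ x′ ++ᵛ x₂))) where
    a₁ a a₂ N : ℕ
    a₁ = length A₁
    a = length A
    a₂ = length A₂
    N = a₁ + (a + (a + a₂))

    v₁ v v′ v₂ : List ℕ
    v₁ = varList x₁
    v = varList x
    v′ = varList x′
    v₂ = varList x₂

    -- The positions of x₁, x, x′ and x₂ before contraction; afterwards x₂ occupies block₂′.
    block₁ blockₓ blockₓ′ block₂ block₂′ : Term L
    block₁ = rangeTerm 0 a₁
    blockₓ = rangeTerm a₁ a
    blockₓ′ = rangeTerm (a₁ + a) a
    block₂ = rangeTerm (a₁ + a + a) a₂
    block₂′ = rangeTerm (a₁ + a) a₂

    before after S : Subst
    before = position (x₁ ++ᵛ x ++ᵛ x′ ++ᵛ x₂)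
    after = position (x₁ ++ᵛ x ++ᵛ x₂)
    S = plug N (contractionTerm a₁ a a₂)

    distinct₁ : Unique (v₁ ++ v ++ v′ ++ v₂)
    distinct₁ = subst Unique (varList-++₄ x₁ x x′ x₂) distinct

    distinctₓ : Unique (v ++ v′ ++ v₂)
    distinctₓ = Unique-++⁻ʳ v₁ distinct₁

    distinctₓ′ : Unique (v′ ++ v₂)
    distinctₓ′ = Unique-++⁻ʳ v distinctₓ

    plug-block₁ : substTermBy S block₁ ≡ block₁
    plug-block₁ = plug-slice 0 a₁ N [] block₁ (blockₓ ++ (blockₓ ++ block₂′)) refl (length-rangeTerm 0 a₁)
      (cong (a₁ +_) (≡.sym (≡.trans (length-++ blockₓ)
        (cong₂ _+_ (length-rangeTerm _ a) (≡.trans (length-++ blockₓ) (cong₂ _+_ (length-rangeTerm _ a) (length-rangeTerm _ a₂)))))))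

    plug-blockₓ : substTermBy S blockₓ ≡ blockₓ
    plug-blockₓ = plug-slice a₁ a N block₁ blockₓ (blockₓ ++ block₂′) (length-rangeTerm 0 a₁) (length-rangeTerm _ a)
      (cong (λ k → a₁ + (a + k)) (≡.sym (≡.trans (length-++ blockₓ) (cong₂ _+_ (length-rangeTerm _ a) (length-rangeTerm _ a₂)))))

    plug-blockₓ′ : substTermBy S blockₓ′ ≡ blockₓ
    plug-blockₓ′ =
      ≡.trans (cong (λ g → substTermBy (plug N g) blockₓ′) (≡.sym (++-assoc block₁ blockₓ (blockₓ ++ block₂′))))
        (plug-slice (a₁ + a) a N (block₁ ++ blockₓ) blockₓ block₂′
          (≡.trans (length-++ block₁) (cong₂ _+_ (length-rangeTerm 0 a₁) (length-rangeTerm _ a))) (length-rangeTerm _ a)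
          (≡.trans (≡.sym (+-assoc a₁ a _)) (cong (λ k → (a₁ + a) + (a + k)) (≡.sym (length-rangeTerm _ a₂)))))

    plug-block₂ : substTermBy S block₂ ≡ block₂′
    plug-block₂ =
      ≡.trans (cong (λ g → substTermBy (plug N g) block₂)
                (≡.trans (cong (λ q → block₁ ++ (blockₓ ++ (blockₓ ++ q))) (≡.sym (++-identityʳ block₂′)))
                  (≡.trans (cong (block₁ ++_) (≡.sym (++-assoc blockₓ blockₓ (block₂′ ++ []))))
                    (≡.sym (++-assoc block₁ (blockₓ ++ blockₓ) (block₂′ ++ []))))))
        (plug-slice (a₁ + a + a) a₂ N (block₁ ++ (blockₓ ++ blockₓ)) block₂′ []
          (≡.trans (length-++ block₁) (≡.trans (cong₂ _+_ (length-rangeTerm 0 a₁)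
            (≡.trans (length-++ blockₓ) (cong₂ _+_ (length-rangeTerm _ a) (length-rangeTerm _ a)))) (≡.sym (+-assoc a₁ a a))))
          (length-rangeTerm _ a₂)
          (≡.trans (≡.sym (+-assoc a₁ a _)) (≡.trans (≡.sym (+-assoc (a₁ + a) a a₂)) (cong ((a₁ + a + a) +_) (≡.sym (+-identityʳ a₂))))))

    after-x₁ : ∀ {z} → z ∈ v₁ → after z ≡ substVar v₁ block₁ z
    after-x₁ {z} m = ≡.trans (position-++₃ x₁ x x₂ z) (substVar-++ˡ v₁ _ block₁ _ m (length-varList-rangeTerm x₁ 0))

    after-x : ∀ {z} → z ∉ v₁ → z ∈ v → after z ≡ substVar v blockₓ z
    after-x {z} n m = ≡.trans (position-++₃ x₁ x x₂ z)
      (≡.trans (substVar-++ʳ v₁ _ block₁ _ n (length-varList-rangeTerm x₁ 0)) (substVar-++ˡ v _ blockₓ _ m (length-varList-rangeTerm x a₁)))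

    after-x₂ : ∀ {z} → z ∉ v₁ → z ∉ v → after z ≡ substVar v₂ block₂′ z
    after-x₂ {z} n n′ = ≡.trans (position-++₃ x₁ x x₂ z)
      (≡.trans (substVar-++ʳ v₁ _ block₁ _ n (length-varList-rangeTerm x₁ 0)) (substVar-++ʳ v _ blockₓ _ n′ (length-varList-rangeTerm x a₁)))

    before-x₁ : ∀ {z} → z ∈ v₁ → before z ≡ substVar v₁ block₁ z
    before-x₁ {z} m = ≡.trans (position-++₄ x₁ x x′ x₂ z) (substVar-++ˡ v₁ _ block₁ _ m (length-varList-rangeTerm x₁ 0))

    before-x : ∀ {z} → z ∉ v₁ → z ∈ v → before z ≡ substVar v blockₓ z
    before-x {z} n m = ≡.trans (position-++₄ x₁ x x′ x₂ z)
      (≡.trans (substVar-++ʳ v₁ _ block₁ _ n (length-varList-rangeTerm x₁ 0)) (substVar-++ˡ v _ blockₓ _ m (length-varList-rangeTerm x a₁)))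

    before-x′ : ∀ {z} → z ∉ v₁ → z ∉ v → z ∈ v′ → before z ≡ substVar v′ blockₓ′ z
    before-x′ {z} n n′ m = ≡.trans (position-++₄ x₁ x x′ x₂ z)
      (≡.trans (substVar-++ʳ v₁ _ block₁ _ n (length-varList-rangeTerm x₁ 0))
        (≡.trans (substVar-++ʳ v _ blockₓ _ n′ (length-varList-rangeTerm x a₁)) (substVar-++ˡ v′ _ blockₓ′ _ m (length-varList-rangeTerm x′ (a₁ + a)))))

    before-x₂ : ∀ {z} → z ∉ v₁ → z ∉ v → z ∉ v′ → before z ≡ substVar v₂ block₂ z
    before-x₂ {z} n n′ n″ = ≡.trans (position-++₄ x₁ x x′ x₂ z)
      (≡.trans (substVar-++ʳ v₁ _ block₁ _ n (length-varList-rangeTerm x₁ 0))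
        (≡.trans (substVar-++ʳ v _ blockₓ _ n′ (length-varList-rangeTerm x a₁)) (substVar-++ʳ v′ _ blockₓ′ _ n″ (length-varList-rangeTerm x′ (a₁ + a)))))

    after-varTerm : substTermBy after (varTerm x) ≡ blockₓ
    after-varTerm = ≡.trans (cong (substTermBy after) (varTerm-map x))
      (≡.trans (substTermBy-cong (map var v) (AllVars-map-var v (λ m → after-x (λ m₁ → Unique-++⇒disjoint v₁ distinct₁ m₁ (∈-++⁺ˡ m)) m)))
        (substTermBy-substVar-vars v blockₓ (Unique-++⁻ˡ v distinctₓ) (≡.trans (length-rangeTerm _ a) (≡.sym (length-varList x)))))

    Commutes : ℕ → Set
    Commutes z = substAtomBy S (before z) ≡ substAtomBy after (substVar v′ (varTerm x) z)

    commutes-x₁ : ∀ {z} → z ∈ v₁ → Commutes z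
    commutes-x₁ {z} m =
      ≡.trans (cong (substAtomBy S) (before-x₁ m))
        (≡.trans (≡.sym (substVar-substTermBy S v₁ block₁ m (length-varList-rangeTerm x₁ 0)))
          (≡.trans (cong (λ q → substVar v₁ q z) plug-block₁)
            (≡.sym (≡.trans (cong (substAtomBy after) (substVar-∉ v′ (varTerm x)
                              (λ m′ → Unique-++⇒disjoint v₁ distinct₁ m (∈-++⁺ʳ v (∈-++⁺ˡ m′)))))
                      (after-x₁ m)))))

    commutes-x : ∀ {z} → z ∉ v₁ → z ∈ v → Commutes z
    commutes-x {z} n m =
      ≡.trans (cong (substAtomBy S) (before-x n m))
        (≡.trans (≡.sym (substVar-substTermBy S v blockₓ m (length-varList-rangeTerm x a₁)))
          (≡.trans (cong (λ q → substVar v q z) plug-blockₓ)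
            (≡.sym (≡.trans (cong (substAtomBy after) (substVar-∉ v′ (varTerm x) (λ m′ → Unique-++⇒disjoint v distinctₓ m (∈-++⁺ˡ m′))))
                      (after-x n m)))))

    commutes-x′ : ∀ {z} → z ∉ v₁ → z ∉ v → z ∈ v′ → Commutes z
    commutes-x′ {z} n n′ m =
      ≡.trans (cong (substAtomBy S) (before-x′ n n′ m))
        (≡.trans (≡.sym (substVar-substTermBy S v′ blockₓ′ m (length-varList-rangeTerm x′ (a₁ + a))))
          (≡.trans (cong (λ q → substVar v′ q z) plug-blockₓ′)
            (≡.sym (≡.trans (≡.sym (substVar-substTermBy after v′ (varTerm x) m (≡.trans (length-varList x′) (≡.sym (length-varTerm x)))))
                      (cong (λ q → substVar v′ q z) after-varTerm)))))

    commutes-x₂ : ∀ {z} → z ∉ v₁ → z ∉ v → z ∉ v′ → z ∈ v₂ → Commutes z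
    commutes-x₂ {z} n n′ n″ m =
      ≡.trans (cong (substAtomBy S) (before-x₂ n n′ n″))
        (≡.trans (≡.sym (substVar-substTermBy S v₂ block₂ m (length-varList-rangeTerm x₂ (a₁ + a + a))))
          (≡.trans (cong (λ q → substVar v₂ q z) plug-block₂)
            (≡.sym (≡.trans (cong (substAtomBy after) (substVar-∉ v′ (varTerm x) n″)) (after-x₂ n n′)))))

    commutes : ∀ {z} → z ∈ varList (x₁ ++ᵛ x ++ᵛ x′ ++ᵛ x₂) → Commutes z
    commutes {z} m with ∈-++⁻ v₁ (subst (z ∈_) (varList-++₄ x₁ x x′ x₂) m)
    ... | inj₁ m₁ = commutes-x₁ m₁
    ... | inj₂ m₁ with ∈-++⁻ v m₁
    ... | inj₁ mₓ = commutes-x (λ m′ → Unique-++⇒disjoint v₁ distinct₁ m′ m₁) mₓ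
    ... | inj₂ mₓ with ∈-++⁻ v′ mₓ
    ... | inj₁ mₓ′ = commutes-x′ (λ m′ → Unique-++⇒disjoint v₁ distinct₁ m′ m₁) (λ m′ → Unique-++⇒disjoint v distinctₓ m′ mₓ) mₓ′
    ... | inj₂ m₂ = commutes-x₂ (λ m′ → Unique-++⇒disjoint v₁ distinct₁ m′ m₁) (λ m′ → Unique-++⇒disjoint v distinctₓ m′ mₓ)
                                (λ m′ → Unique-++⇒disjoint v′ distinctₓ′ m′ m₂) m₂

  position-contr : ∀ {A₁ A A₂ : List Sort} (x₁ : Vars A₁) (x x′ : Vars A) (x₂ : Vars A₂) t →
      (u : Unique (varList (x₁ ++ᵛ x ++ᵛ x′ ++ᵛ x₂))) → AllVars (_∈ varList (x₁ ++ᵛ x ++ᵛ x′ ++ᵛ x₂)) t →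
      substTermBy (plug (length A₁ + (length A + (length A + length A₂))) (contractionTerm (length A₁) (length A) (length A₂)))
        (substTermBy (position (x₁ ++ᵛ x ++ᵛ x′ ++ᵛ x₂)) t)
      ≡ substTermBy (position (x₁ ++ᵛ x ++ᵛ x₂)) (t [ varTerm x / varList x′ ])
  position-contr x₁ x x′ x₂ t u fv =
    begin
      substTermBy S (substTermBy before t)                   ≡⟨ substTermBy-∘ S before t ⟩
      substTermBy (λ z → substAtomBy S (before z)) t          ≡⟨ substTermBy-cong t (AllVars-mono commutes t fv) ⟩
      substTermBy (λ z → substAtomBy after (substVar v′ (varTerm x) z)) t
                                                              ≡⟨ substTermBy-∘ after (substVar v′ (varTerm x)) t ⟨
      substTermBy after (substTermBy (substVar v′ (varTerm x)) t)
                                                              ≡⟨ cong (substTermBy after) (substTerm-substVar v′ (varTerm x) t) ⟨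
      substTermBy after (t [ varTerm x / v′ ])                ∎
    where
    open Contraction x₁ x x′ x₂ u

  mutual
    ⟦⟧-position : ∀ {A B : List Sort} {x : Vars A} {t} (d : Der x t B) → proj₁ (I.⟦ d ⟧d) ≡ substTermBy (position x) t
    ⟦⟧-position (var x a) = cong (_∷ []) (≡.sym (substVar-here x [] (var 0) []))
    ⟦⟧-position (fun {A} {x} {ts} f args u) =
      ≡.trans (coherence-∘ˡ (idʰ-cast (≡.sym (++-identityʳ (cod f ∷ [])))) refl (Prestructure.func generic f ∘ʰ I.⟦ args ⟧a))
        (cong (λ v → app f v ∷ []) chain)
      where
      chain : substTermsBy (plug (length (interp (dom f))) (proj₁ I.⟦ args ⟧a)) (singletons (varTerm (canon 0 (dom f))))
              ≡ substTermsBy (position x) ts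
      chain =
        ≡.trans (cong₂ (λ n v → substTermsBy (plug n (proj₁ I.⟦ args ⟧a)) (singletons v)) (length-interp (dom f)) (varTerm-canon 0 (dom f)))
          (≡.trans (plug-singletons 0 (length (dom f)) _ (≡.trans (length-hom I.⟦ args ⟧a) (length-interp (dom f))))
            (≡.trans (cong singletons (⟦⟧a-position args u))
              (singletons-concat (substTermsBy (position x) ts) (length-args (position x) args))))
    ⟦⟧-position (sub {A} {B} {C} {x} {y} {s} {t} d₁ d₂) = begin
      substTermBy (plug (length (interp B)) (proj₁ I.⟦ d₁ ⟧d)) (proj₁ I.⟦ d₂ ⟧d)
        ≡⟨ cong₂ (λ n v → substTermBy (plug n v) (proj₁ I.⟦ d₂ ⟧d)) (length-interp B) (⟦⟧-position d₁) ⟩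
      substTermBy S (proj₁ I.⟦ d₂ ⟧d)
        ≡⟨ cong (substTermBy S) (⟦⟧-position d₂) ⟩
      substTermBy S (substTermBy (position y) t)
        ≡⟨ substTermBy-∘ S (position y) t ⟩
      substTermBy (λ z → substAtomBy S (position y z)) t
        ≡⟨ substTermBy-cong t (AllVars-mono commutes t (vars-der d₂)) ⟩
      substTermBy (λ z → substAtomBy (position x) (substVar (varList y) s z)) t
        ≡⟨ substTermBy-∘ (position x) (substVar (varList y) s) t ⟨
      substTermBy (position x) (substTermBy (substVar (varList y) s) t)
        ≡⟨ cong (substTermBy (position x)) (substTerm-substVar (varList y) s t) ⟨
      substTermBy (position x) (t [ s / varList y ]) ∎
      where
      S : Subst
      S = plug (length B) (substTermBy (position x) s)
      commutes : ∀ {z} → z ∈ varList y → substAtomBy S (position y z) ≡ substAtomBy (position x) (substVar (varList y) s z)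
      commutes m =
        ≡.trans (substVar-rename (range 0 (length B)) (varList y) (substTermBy (position x) s) (Unique-range 0 _) m
                   (≡.trans (length-varList y) (≡.sym (length-range 0 _)))
                   (≡.trans (length-substTermBy (position x) s) (≡.trans (length-der d₁) (≡.sym (length-range 0 _)))))
          (substVar-substTermBy (position x) (varList y) s m (≡.trans (length-varList y) (≡.sym (length-der d₁))))
    ⟦⟧-position empty = refl
    ⟦⟧-position (tens {A} {B} {C} {D'} {x} {y} {s} {t} d₁ d₂ u) =
      ≡.trans (coherence-∘ˡ (I.mrg B D') (merge-coherence B D') ((I.⟦ d₁ ⟧d ⊗ʰ I.⟦ d₂ ⟧d) ∘ʰ I.spl A C))
      (≡.trans (coherence-∘ʳ (I.⟦ d₁ ⟧d ⊗ʰ I.⟦ d₂ ⟧d) (I.spl A C) (split-coherence A C))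
      (≡.trans (cong₂ (λ v w → v ++ substTermBy (shift (length (interp A))) w) (⟦⟧-position d₁) (⟦⟧-position d₂))
      (≡.trans (cong (λ n → substTermBy (position x) s ++ substTermBy (shift n) (substTermBy (position y) t)) (length-interp A))
         (position-tens x y s t u (vars-der d₁) (vars-der d₂)))))
    ⟦⟧-position (weak w {A₁} {A₂} {A₃} {B} {x₁} {x₂} {x₃} {t} d u) =
      ≡.trans (cong₂ (λ n v → substTermBy (plug n v) (proj₁ I.⟦ d ⟧d))
                 (≡.trans (length-interp (A₁ ++ A₃)) (length-++ A₁)) (weakening-term w A₁ A₂ A₃))
      (≡.trans (cong (substTermBy _) (⟦⟧-position d)) (position-weak x₁ x₂ x₃ t u (distinct-der d) (vars-der d)))
    ⟦⟧-position (exch e {A} {B} {x} {t} τ d) =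
      ≡.trans (cong₂ (λ n v → substTermBy (plug n (varTerm (inverseVars A τ))) v) (length-interp A) (⟦⟧-position d))
        (position-exch x t τ (distinct-der d) (distinct-der (exch e τ d)) (vars-der d))
    ⟦⟧-position (contr c {A₁} {A} {A₂} {B} {x₁} {x} {x′} {x₂} {t} d) =
      ≡.trans (cong₂ (λ n v → substTermBy (plug n v) (proj₁ I.⟦ d ⟧d))
                 (≡.trans (length-interp (A₁ ++ A ++ A ++ A₂)) (length-++₄ A₁ A A₂)) (contraction-term c A₁ A A₂))
        (≡.trans (cong (substTermBy _) (⟦⟧-position d)) (position-contr x₁ x x′ x₂ t (distinct-der d) (vars-der d)))

    ⟦⟧a-position : ∀ {A : List Sort} {bs} {x : Vars A} {ts} (as : Args L x ts bs) → Distinct L x →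
        proj₁ (I.⟦ as ⟧a) ≡ concat (substTermsBy (position x) ts)
    ⟦⟧a-position [] _ = refl
    ⟦⟧a-position (_∷_ {A} {As} {b} {bs} {x} {xs} {t} {ts} d args) u =
      ≡.trans (coherence-∘ʳ ((idʰ-cast (++-identityʳ (b ∷ [])) ∘ʰ I.⟦ d ⟧d) ⊗ʰ I.⟦ args ⟧a) (I.spl A As) (split-coherence A As))
      (≡.trans (cong₂ (λ v w → v ++ substTermBy (shift (length (interp A))) w) (≡.trans (coherence-∘ˡ (idʰ-cast (++-identityʳ (b ∷ []))) refl I.⟦ d ⟧d) (⟦⟧-position d)) (⟦⟧a-position args uxs))
      (≡.trans (cong (λ n → substTermBy (position x) t ++ substTermBy (shift n) (concat (substTermsBy (position xs) ts))) (length-interp A))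
      (cong₂ _++_ (substTermBy-cong t (AllVars-mono (λ m → ≡.sym (position-++ˡ x xs m)) t (vars-der d)))
        (≡.trans (substTermBy-concat (shift (length A)) (substTermsBy (position xs) ts))
          (cong concat (≡.trans (substTermsBy-∘ (shift (length A)) (position xs) ts) (substTermsBy-cong ts (AllVarsˢ-mono (λ m → position-++ʳ x xs uq' m) ts (vars-args args)))))))))
      where
      uq' : Unique (varList x ++ varList xs)
      uq' = subst Unique (varList-++ x xs) u
      uxs : Unique (varList xs)
      uxs = Unique-++⁻ʳ (varList x) uq'

  genericStructure : Structure TermCategory L
  genericStructure = record
    { prestructure = generic
    ; coherent = λ d d′ → ≡⇒≈ {f = I.⟦ d ⟧d} {I.⟦ d′ ⟧d} (≡.trans (⟦⟧-position d) (≡.sym (⟦⟧-position d′)))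
    }

  thm-rename-positions : ∀ {A B : List Sort} {x : Vars A} {l r} → Thm 𝕋 x l r B →
      Thm 𝕋 (canon 0 (interp A)) (substTermBy (position x) l) (substTermBy (position x) r) (interp B)
  thm-rename-positions {A} {B} {x} {l} {r} p =
    subst (Thm 𝕋 (canon 0 (interp A)) (substTermBy (position x) l) (substTermBy (position x) r)) (≡.sym (interp≡ B))
      (castThm (toPositions l) (toPositions r) (sub (refl canonVars) p))
    where
    canonVars : Der (canon 0 (interp A)) (varTerm (canon 0 (interp A))) A
    canonVars = subst (Der (canon 0 (interp A)) (varTerm (canon 0 (interp A)))) (interp≡ A)
                  (varTerm-der (canon 0 (interp A)) (canon-distinct 0 (interp A)))
    toPositions : ∀ s → s [ varTerm (canon 0 (interp A)) / varList x ] ≡ substTermBy (position x) s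
    toPositions s =
      ≡.trans (substTerm-substVar (varList x) _ s)
        (cong (λ u → substTermBy (substVar (varList x) u) s) (≡.trans (varTerm-canon 0 (interp A)) (cong (rangeTerm 0) (length-interp A))))

  genericModel : Model TermCategory 𝕋
  genericModel = record
    { structure = genericStructure
    ; satisfies = λ φ a → castThm (≡.sym (⟦⟧-position (Formula.lhsTerm φ))) (≡.sym (⟦⟧-position (Formula.rhsTerm φ)))
                                   (thm-rename-positions (ax φ a))
    }

  plug-position : ∀ {A : List Sort} (x : Vars A) s → AllVars (_∈ varList x) s →
      substTermBy (plug (length A) (varTerm x)) (substTermBy (position x) s) ≡ s
  plug-position {A} x s fv = ≡.trans (substTermBy-∘ _ _ s) (≡.trans (substTermBy-cong s (AllVars-mono unplug s fv)) (substTermBy-var s))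
    where
    unplug : ∀ {z} → z ∈ varList x → substAtomBy (plug (length A) (varTerm x)) (position x z) ≡ var z
    unplug {z} m = ≡.trans (substVar-rename (range 0 (length A)) (varList x) (varTerm x) (Unique-range 0 _) m
                         (≡.trans (length-varList x) (≡.sym (length-range 0 _))) (≡.trans (length-varTerm x) (≡.sym (length-range 0 _))))
                 (≡.trans (cong (λ u → substVar (varList x) u z) (varTerm-map x)) (substVar-self (varList x) z))

  completeness : (φ : Formula L) → Valid 𝕋 φ → IsTheorem 𝕋 φ
  completeness (formula {A} x B l r dl dr) valid =
    castThm (unrename dl) (unrename dr) (sub (refl (varTerm-der x (distinct-der dl))) holdsGenerically)
    where
    holdsGenerically : Thm 𝕋 (canon 0 A) (substTermBy (position x) l) (substTermBy (position x) r) B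
    holdsGenerically =
      castThmTypes (interp≡ A) (interp≡ B) (castThm (⟦⟧-position dl) (⟦⟧-position dr) (valid TermCategory genericModel))
    unrename : ∀ {s} → Der x s B → substTermBy (position x) s [ varTerm x / varList (canon 0 A) ] ≡ s
    unrename {s} d = ≡.trans (substTerm-canon A (varTerm x) (substTermBy (position x) s)) (plug-position x s (vars-der d))

theorem4p4 : (L : Language) (𝕋 : Theory L) (φ : Formula L) → IsTheorem 𝕋 φ ⇔ω Valid 𝕋 φ
theorem4p4 L 𝕋 φ = record { to = soundness 𝕋 φ ; from = Generic.completeness L 𝕋 φ }
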